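{- Let $k\ge1$, $\pi\in S_k$, $i,j\in[k]$, and let $p=(\pi,R)$ with $R=\big([k]\times([k]\setminus\{i\})\big)\cup\{(j,i)\}$ (all rows of boxes fully shaded except row $i$, in which exactly the box $(j,i)$ is shaded). Then for every $n\ge k$, \[ s_n^+(p)=\frac{(n-1)!}{(k-1)!}\qquad\text{and}\qquad\lim_{n\to\infty}\frac{s_n^+(p)}{n!}=0. \]
   Context: For $n\ge1$, $S_n$ is the set of permutations of $\{1,\dots,n\}$ in one-line notation $\tau=\tau_1\cdots\tau_n$. For an integer $k\ge0$ write $[k]=\{0,1,\dots,k\}$. A mesh pattern of length $k$ is a pair $(\pi,R)$ with $\pi\in S_k$ and $R\subseteq[k]\times[k]$; the elements $(x,y)\in R$ are the shaded boxes (box $(x,y)$ is the unit square with south-west corner $(x,y)$ in the plot of the points $(i,\pi_i)$); row $y$ of boxes is $[k]\times\{y\}$. An occurrence of $(\pi,R)$ in $\tau\in S_n$ is a choice of positions $i_1<\dots<i_k$ such that $\tau_{i_a}<\tau_{i_b}$ iff $\pi_a<\pi_b$ for all $a,b$, and such that for every $(x,y)\in R$ there is no index $m$ with $i_x<m<i_{x+1}$ and $v_y<\tau_m<v_{y+1}$, where $i_0=0$, $i_{k+1}=n+1$, $v_0=0$, $v_{k+1}=n+1$, and for $1\le y\le k$, $v_y$ is the $y$-th smallest of the values $\tau_{i_1},\dots,\tau_{i_k}$. A permutation contains a mesh pattern if it has at least one occurrence of it, and $s_n^+(p)$ denotes the number of permutations in $S_n$ containing $p$. -}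

module Defs where

open import Data.Bool using (Bool; true; false; _∧_; _∨_; not; if_then_else_)
open import Data.Nat using (ℕ; zero; suc; _+_; _∸_; _≡ᵇ_; _<ᵇ_)
open import Data.List using (List; []; _∷_; _++_; map; concatMap; filter; length)
open import Data.Bool.ListAction using (all; any)
open import Data.Product using (_×_; _,_; proj₁; proj₂)
open import Relation.Nullary.Decidable using (Dec; yes; no)
open import Data.Bool using (T)
open import Data.Bool.Properties using (T?)

-- Conventions: a permutation τ ∈ S_n is the list [τ₁, …, τₙ] of its
-- one-line notation (values in 1..n); positions are 1-based.

range : ℕ → ℕ → List ℕ
range a b = go (suc b ∸ a) a
  where
  go : ℕ → ℕ → List ℕ
  go zero    _ = []
  go (suc c) x = x ∷ go c (suc x)

elem : ℕ → List ℕ → Bool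
elem v xs = any (λ w → v ≡ᵇ w) xs

-- τ_m for 1-based position m (0 outside 1..length τ; never used there)
at : List ℕ → ℕ → ℕ
at []       _             = 0
at (x ∷ xs) zero          = 0
at (x ∷ xs) (suc zero)    = x
at (x ∷ xs) (suc (suc m)) = at xs (suc m)

allLists : ℕ → ℕ → List (List ℕ)
allLists n zero    = [] ∷ []
allLists n (suc m) = concatMap (λ v → map (v ∷_) (allLists n m)) (range 1 n)

isPerm : ℕ → List ℕ → Bool
isPerm n τ = (length τ ≡ᵇ n) ∧ all (λ v → elem v τ) (range 1 n)

S : ℕ → List (List ℕ)
S n = filter (λ τ → T? (isPerm n τ)) (allLists n n)

choose : List ℕ → ℕ → List (List ℕ)
choose xs       zero    = [] ∷ []
choose []       (suc k) = []
choose (x ∷ xs) (suc k) = map (x ∷_) (choose xs k) ++ choose xs (suc k)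

-- A mesh pattern (π, R): π ∈ S_k (one-line notation) and the set R of
-- shaded boxes given by its characteristic function on [k] × [k].
record MeshPattern : Set where
  constructor mesh
  field
    len    : ℕ
    pat    : List ℕ
    shaded : ℕ → ℕ → Bool
open MeshPattern public

occurrence : ℕ → List ℕ → MeshPattern → List ℕ → Bool
occurrence n τ p is = iso ∧ boxes
  where
  k    = len p
  π    = pat p
  vals = map (at τ) is
  -- order isomorphism: τ_{i_a} < τ_{i_b} iff π_a < π_b
  iso  = all (λ a → all (λ b → not ((at vals a <ᵇ at vals b) ∧ not (at π a <ᵇ at π b))
                               ∧ not ((at π a <ᵇ at π b) ∧ not (at vals a <ᵇ at vals b)))
                   (range 1 k)) (range 1 k)
  -- i₀ = 0, i_{k+1} = n+1 ; index x ∈ [k]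
  I : ℕ → ℕ
  I x = at (0 ∷ is ++ (suc n ∷ [])) (suc x)
  -- v₀ = 0, v_y = y-th smallest of vals, v_{k+1} = n+1
  sorted = filter (λ w → T? (elem w vals)) (range 1 n)
  V : ℕ → ℕ
  V y = at (0 ∷ sorted ++ (suc n ∷ [])) (suc y)
  empty : ℕ → ℕ → Bool
  empty x y = all (λ m → not ((I x <ᵇ m) ∧ (m <ᵇ I (suc x))
                              ∧ (V y <ᵇ at τ m) ∧ (at τ m <ᵇ V (suc y))))
                  (range 1 n)
  boxes = all (λ x → all (λ y → not (shaded p x y) ∨ empty x y) (range 0 k)) (range 0 k)

contains : ℕ → MeshPattern → List ℕ → Bool
contains n p τ = any (occurrence n τ p) (choose (range 1 n) (len p))

s⁺ : ℕ → MeshPattern → ℕ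
s⁺ n p = length (filter (λ τ → T? (contains n p τ)) (S n))

R-thm : ℕ → ℕ → ℕ → ℕ → Bool
R-thm i j x y = not (y ≡ᵇ i) ∨ (x ≡ᵇ j)

{-# OPTIONS --safe #-}
module Submission where

-- Since every row but row i is shaded, an occurrence must use exactly the i smallest and the
-- k - i largest values of τ, and these must appear in τ in the order of π; the shaded box (j , i)
-- then says that none of the n - k remaining "middle" values lies between the j-th and (j+1)-th of
-- them. Conversely these two conditions give an occurrence. Counting, the extreme values are in a
-- fixed order and the middle values are placed, in any order, into k of the k + 1 gaps, which gives
-- (n - k)! binomial(n - 1, k - 1) = (n - 1)! / (k - 1)! permutations. The count is carried out by
-- a recursion over the first letter of τ, read by a small automaton (`accepts`).

open import Defs
open import Data.Bool using (Bool; true; false; _∧_; _∨_; not; if_then_else_; T)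
open import Data.Bool.Properties using (T?; ∧-identityʳ; ∧-zeroʳ; ∧-idem; ∧-commutativeMonoid)
open import Data.List using (List; []; _∷_; _++_; map; concatMap; filter; length)
open import Data.Bool.ListAction using (all; any)
open import Data.Nat using (ℕ; zero; suc; _+_; _*_; _∸_; _≤_; _<_; _!; z≤n; s≤s; _≡ᵇ_; _<ᵇ_; >-nonZero)
open import Data.Nat.Properties
open import Relation.Binary.Definitions using (tri<; tri≈; tri>)
open import Data.Product using (_×_; _,_; proj₁; proj₂; ∃-syntax)
open import Data.Sum using (_⊎_; inj₁; inj₂)
open import Data.Empty using (⊥; ⊥-elim)
open import Relation.Binary.PropositionalEquality
open import Relation.Nullary using (¬_; yes; no)
open import Data.List.Membership.Propositional using (_∈_; find)
open import Data.List.Properties using (length-map; length-++; map-++; map-cong-local; map-id-local)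
open import Data.List.Relation.Unary.All using (tabulate)
open import Data.List.Membership.Propositional.Properties using (∈-map⁺; ∈-map⁻; ∈-++⁺ˡ; ∈-++⁺ʳ; ∈-++⁻; ∈-concatMap⁻)
open import Data.List.Relation.Unary.Any using (here; there)
open import Data.Nat.Solver using (module +-*-Solver)
open +-*-Solver using (solve; _:+_; _:*_; _:=_)
open import Algebra.Bundles using (CommutativeMonoid)
open import Algebra.Properties.CommutativeSemigroup +-commutativeSemigroup using () renaming (interchange to +-interchange; x∙yz≈y∙xz to +-exchangeˡ)
open import Algebra.Properties.CommutativeSemigroup *-commutativeSemigroup using () renaming (x∙yz≈y∙xz to *-exchangeˡ)
open import Algebra.Properties.CommutativeSemigroup (CommutativeMonoid.commutativeSemigroup ∧-commutativeMonoid)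
  using () renaming (xy∙z≈xz∙y to ∧-swapʳ)

true≢false : true ≡ false → ⊥
true≢false ()

∧-elimˡ : ∀ {a b} → (a ∧ b) ≡ true → a ≡ true
∧-elimˡ {true} _ = refl

∧-elimʳ : ∀ {a b} → (a ∧ b) ≡ true → b ≡ true
∧-elimʳ {true} e = e

∧-intro : ∀ {a b} → a ≡ true → b ≡ true → (a ∧ b) ≡ true
∧-intro refl refl = refl

∧-falseˡ : ∀ {a} b → a ≡ false → (a ∧ b) ≡ false
∧-falseˡ b refl = refl

∧-falseʳ : ∀ a {b} → b ≡ false → (a ∧ b) ≡ false
∧-falseʳ false refl = refl
∧-falseʳ true refl = refl

∨-introˡ : ∀ {a} b → a ≡ true → (a ∨ b) ≡ true
∨-introˡ b refl = refl

∨-introʳ : ∀ a {b} → b ≡ true → (a ∨ b) ≡ true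
∨-introʳ false refl = refl
∨-introʳ true refl = refl

∨-elim : ∀ {a b} → (a ∨ b) ≡ true → a ≡ true ⊎ b ≡ true
∨-elim {true} _ = inj₁ refl
∨-elim {false} e = inj₂ e

true-or-false : ∀ b → b ≡ true ⊎ b ≡ false
true-or-false true = inj₁ refl
true-or-false false = inj₂ refl

false≢true : ∀ {b} → b ≡ false → b ≡ true → ⊥
false≢true refl ()

T⇒≡true : ∀ {b} → T b → b ≡ true
T⇒≡true {true} _ = refl

≡true⇒T : ∀ {b} → b ≡ true → T b
≡true⇒T refl = _

⇔ᵇ⇒≡ : ∀ X Y → (not (X ∧ not Y) ∧ not (Y ∧ not X)) ≡ true → X ≡ Y
⇔ᵇ⇒≡ true true _ = refl
⇔ᵇ⇒≡ false false _ = refl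

⇔ᵇ-refl : ∀ X → (not (X ∧ not X) ∧ not (X ∧ not X)) ≡ true
⇔ᵇ-refl true = refl
⇔ᵇ-refl false = refl

if-true : {A : Set} (b : Bool) (x y : A) → b ≡ true → (if b then x else y) ≡ x
if-true b x y refl = refl

if-false-0 : ∀ {b} X → b ≡ false → (if b then 0 else X) ≡ X
if-false-0 X refl = refl

if-true-0 : ∀ {b} X → b ≡ true → (if b then 0 else X) ≡ 0
if-true-0 X refl = refl

all-elim : {A : Set} (f : A → Bool) (xs : List A) → all f xs ≡ true → ∀ {x} → x ∈ xs → f x ≡ true
all-elim f (y ∷ xs) e (here refl) = ∧-elimˡ e
all-elim f (y ∷ xs) e (there p) = all-elim f xs (∧-elimʳ {f y} e) p

all-intro : {A : Set} (f : A → Bool) (xs : List A) → (∀ x → x ∈ xs → f x ≡ true) → all f xs ≡ true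
all-intro f [] h = refl
all-intro f (x ∷ xs) h = ∧-intro (h x (here refl)) (all-intro f xs (λ y p → h y (there p)))

all-cong : {A : Set} (f g : A → Bool) (xs : List A) → (∀ x → f x ≡ g x) → all f xs ≡ all g xs
all-cong f g [] h = refl
all-cong f g (x ∷ xs) h = cong₂ _∧_ (h x) (all-cong f g xs h)

any-intro : {A : Set} (f : A → Bool) (xs : List A) → ∀ {x} → x ∈ xs → f x ≡ true → any f xs ≡ true
any-intro f (y ∷ xs) (here refl) e = ∨-introˡ (any f xs) e
any-intro f (y ∷ xs) (there p) e = ∨-introʳ (f y) (any-intro f xs p e)

any-elim : {A : Set} (f : A → Bool) (xs : List A) → any f xs ≡ true → ∃[ x ] (x ∈ xs × f x ≡ true)
any-elim f (y ∷ xs) e with ∨-elim {f y} e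
... | inj₁ p = y , here refl , p
... | inj₂ p with any-elim f xs p
... | x , q , r = x , there q , r

any-cong : {A : Set} (f g : A → Bool) (xs : List A) → (∀ x → f x ≡ g x) → any f xs ≡ any g xs
any-cong f g [] h = refl
any-cong f g (x ∷ xs) h = cong₂ _∨_ (h x) (any-cong f g xs h)

<ᵇ-true : ∀ m n → m < n → (m <ᵇ n) ≡ true
<ᵇ-true m n p = T⇒≡true (<⇒<ᵇ p)

<ᵇ-false : ∀ m n → n ≤ m → (m <ᵇ n) ≡ false
<ᵇ-false m zero _ = refl
<ᵇ-false (suc m) (suc n) (s≤s p) = <ᵇ-false m n p

<ᵇ-true⁻ : ∀ m n → (m <ᵇ n) ≡ true → m < n
<ᵇ-true⁻ m n e = <ᵇ⇒< m n (≡true⇒T e)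

<ᵇ-false⁻ : ∀ m n → (m <ᵇ n) ≡ false → n ≤ m
<ᵇ-false⁻ m zero _ = z≤n
<ᵇ-false⁻ (suc m) (suc n) e = s≤s (<ᵇ-false⁻ m n e)
<ᵇ-false⁻ zero (suc n) ()

≡ᵇ-true : ∀ m n → m ≡ n → (m ≡ᵇ n) ≡ true
≡ᵇ-true m n e = T⇒≡true (≡⇒≡ᵇ m n e)

≡ᵇ-true⁻ : ∀ m n → (m ≡ᵇ n) ≡ true → m ≡ n
≡ᵇ-true⁻ m n e = ≡ᵇ⇒≡ m n (≡true⇒T e)

≡ᵇ-false : ∀ m n → ¬ m ≡ n → (m ≡ᵇ n) ≡ false
≡ᵇ-false zero zero ne = ⊥-elim (ne refl)
≡ᵇ-false zero (suc n) _ = refl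
≡ᵇ-false (suc m) zero _ = refl
≡ᵇ-false (suc m) (suc n) ne = ≡ᵇ-false m n (λ e → ne (cong suc e))

∸-suc : ∀ {a m} → a < m → m ∸ a ≡ suc (m ∸ suc a)
∸-suc {zero} {suc m} _ = refl
∸-suc {suc a} {suc m} (s≤s p) = ∸-suc {a} {m} p

nothing-strictly-between : ∀ a u → ((a <ᵇ u) ∧ (u <ᵇ suc a)) ≡ false
nothing-strictly-between a u with true-or-false (a <ᵇ u)
... | inj₂ e rewrite e = refl
... | inj₁ e rewrite e = <ᵇ-false u (suc a) (<ᵇ-true⁻ a u e)

*-if0 : ∀ a b X → a * (if b then 0 else X) ≡ (if b then 0 else a * X)
*-if0 a true X = *-zeroʳ a
*-if0 a false X = refl

*-+-exchange : ∀ a X Y b S → (a * X + Y) * (b * S) ≡ a * (X * (b * S)) + b * (Y * S)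
*-+-exchange = solve 5 (λ a X Y b S → (a :* X :+ Y) :* (b :* S) := a :* (X :* (b :* S)) :+ b :* (Y :* S)) refl

filterB : {A : Set} → (A → Bool) → List A → List A
filterB f [] = []
filterB f (x ∷ xs) = if f x then x ∷ filterB f xs else filterB f xs

filter≡filterB : {A : Set} (f : A → Bool) (xs : List A) → filter (λ x → T? (f x)) xs ≡ filterB f xs
filter≡filterB f [] = refl
filter≡filterB f (x ∷ xs) with f x
... | true = cong (x ∷_) (filter≡filterB f xs)
... | false = filter≡filterB f xs

∈-filterB⁺ : {A : Set} (f : A → Bool) (xs : List A) {x : A} → x ∈ xs → f x ≡ true → x ∈ filterB f xs
∈-filterB⁺ f (y ∷ xs) (here refl) e rewrite e = here refl
∈-filterB⁺ f (y ∷ xs) (there p) e with f y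
... | true = there (∈-filterB⁺ f xs p e)
... | false = ∈-filterB⁺ f xs p e

∈-filterB⁻ : {A : Set} (f : A → Bool) (xs : List A) {x : A} → x ∈ filterB f xs → x ∈ xs × f x ≡ true
∈-filterB⁻ f (y ∷ xs) p with f y in eq
∈-filterB⁻ f (y ∷ xs) (here refl) | true = here refl , eq
∈-filterB⁻ f (y ∷ xs) (there p) | true with ∈-filterB⁻ f xs p
... | q , r = there q , r
∈-filterB⁻ f (y ∷ xs) p | false with ∈-filterB⁻ f xs p
... | q , r = there q , r

filterB-cong : {A : Set} (f g : A → Bool) (xs : List A) → (∀ x → x ∈ xs → f x ≡ g x) → filterB f xs ≡ filterB g xs
filterB-cong f g [] h = refl
filterB-cong f g (x ∷ xs) h with f x | g x | h x (here refl)
... | true | .true | refl = cong (x ∷_) (filterB-cong f g xs (λ y p → h y (there p)))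
... | false | .false | refl = filterB-cong f g xs (λ y p → h y (there p))

filterB-++ : (f : ℕ → Bool) (xs ys : List ℕ) → filterB f (xs ++ ys) ≡ filterB f xs ++ filterB f ys
filterB-++ f [] ys = refl
filterB-++ f (x ∷ xs) ys with f x
... | true = cong (x ∷_) (filterB-++ f xs ys)
... | false = filterB-++ f xs ys

filterB-all : (f : ℕ → Bool) (xs : List ℕ) → (∀ x → x ∈ xs → f x ≡ true) → filterB f xs ≡ xs
filterB-all f [] h = refl
filterB-all f (x ∷ xs) h rewrite h x (here refl) = cong (x ∷_) (filterB-all f xs (λ y p → h y (there p)))

filterB-none : (f : ℕ → Bool) (xs : List ℕ) → (∀ x → x ∈ xs → f x ≡ false) → filterB f xs ≡ []
filterB-none f [] h = refl
filterB-none f (x ∷ xs) h rewrite h x (here refl) = filterB-none f xs (λ y p → h y (there p))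

countB : {A : Set} → (A → Bool) → List A → ℕ
countB f [] = 0
countB f (x ∷ xs) = if f x then suc (countB f xs) else countB f xs

length-filterB : {A : Set} (f : A → Bool) (xs : List A) → length (filterB f xs) ≡ countB f xs
length-filterB f [] = refl
length-filterB f (x ∷ xs) with f x
... | true = cong suc (length-filterB f xs)
... | false = length-filterB f xs

countB-cong : {A : Set} (f g : A → Bool) (xs : List A) → (∀ x → x ∈ xs → f x ≡ g x) → countB f xs ≡ countB g xs
countB-cong f g [] h = refl
countB-cong f g (x ∷ xs) h with f x | g x | h x (here refl)
... | true | .true | refl = cong suc (countB-cong f g xs (λ y p → h y (there p)))
... | false | .false | refl = countB-cong f g xs (λ y p → h y (there p))

countB-ext : {A : Set} (f g : A → Bool) (xs : List A) → (∀ x → f x ≡ g x) → countB f xs ≡ countB g xs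
countB-ext f g xs h = countB-cong f g xs (λ x _ → h x)

countB-++ : {A : Set} (f : A → Bool) (xs ys : List A) → countB f (xs ++ ys) ≡ countB f xs + countB f ys
countB-++ f [] ys = refl
countB-++ f (x ∷ xs) ys with f x
... | true = cong suc (countB-++ f xs ys)
... | false = countB-++ f xs ys

countB-map : {A B : Set} (f : B → Bool) (h : A → B) (xs : List A) → countB f (map h xs) ≡ countB (λ x → f (h x)) xs
countB-map f h [] = refl
countB-map f h (x ∷ xs) with f (h x)
... | true = cong suc (countB-map f h xs)
... | false = countB-map f h xs

countB-filterB : {A : Set} (f g : A → Bool) (xs : List A) → countB f (filterB g xs) ≡ countB (λ x → g x ∧ f x) xs
countB-filterB f g [] = refl
countB-filterB f g (x ∷ xs) with g x
... | false = countB-filterB f g xs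
... | true with f x
... | true = cong suc (countB-filterB f g xs)
... | false = countB-filterB f g xs

countB-true : {A : Set} (xs : List A) → countB (λ _ → true) xs ≡ length xs
countB-true [] = refl
countB-true (x ∷ xs) = cong suc (countB-true xs)

countB-false : {A : Set} (xs : List A) → countB (λ _ → false) xs ≡ 0
countB-false [] = refl
countB-false (x ∷ xs) = countB-false xs

countB≤length : {A : Set} (f : A → Bool) (xs : List A) → countB f xs ≤ length xs
countB≤length f [] = z≤n
countB≤length f (x ∷ xs) with f x
... | true = s≤s (countB≤length f xs)
... | false = m≤n⇒m≤1+n (countB≤length f xs)

countB-mono : {A : Set} (f g : A → Bool) (xs : List A) → (∀ x → x ∈ xs → f x ≡ true → g x ≡ true) → countB f xs ≤ countB g xs
countB-mono f g [] h = z≤n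
countB-mono f g (x ∷ xs) h with f x in ef | g x in eg
... | true | true = s≤s (countB-mono f g xs (λ y p → h y (there p)))
... | true | false = ⊥-elim (true≢false (trans (sym (h x (here refl) ef)) eg))
... | false | true = m≤n⇒m≤1+n (countB-mono f g xs (λ y p → h y (there p)))
... | false | false = countB-mono f g xs (λ y p → h y (there p))

countB-mono-< : {A : Set} (f g : A → Bool) (xs : List A) → (∀ x → x ∈ xs → f x ≡ true → g x ≡ true) →
  ∀ {w} → w ∈ xs → g w ≡ true → f w ≡ false → countB f xs < countB g xs
countB-mono-< f g (x ∷ xs) h (here refl) gw fw rewrite gw | fw = s≤s (countB-mono f g xs (λ y p → h y (there p)))
countB-mono-< f g (x ∷ xs) h (there p) gw fw with f x in ef | g x in eg
... | true | true = s≤s (countB-mono-< f g xs (λ y q → h y (there q)) p gw fw)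
... | true | false = ⊥-elim (true≢false (trans (sym (h x (here refl) ef)) eg))
... | false | true = m<n⇒m<1+n (countB-mono-< f g xs (λ y q → h y (there q)) p gw fw)
... | false | false = countB-mono-< f g xs (λ y q → h y (there q)) p gw fw

countB-none : {A : Set} (f : A → Bool) (xs : List A) → (∀ x → x ∈ xs → f x ≡ false) → countB f xs ≡ 0
countB-none f [] h = refl
countB-none f (x ∷ xs) h rewrite h x (here refl) = countB-none f xs (λ y p → h y (there p))

countB-none⁻ : {A : Set} (f : A → Bool) (xs : List A) → countB f xs ≡ 0 → ∀ x → x ∈ xs → f x ≡ false
countB-none⁻ f (y ∷ xs) e x p with f y in ey
countB-none⁻ f (y ∷ xs) () x p | true
countB-none⁻ f (y ∷ xs) e x (here refl) | false = ey
countB-none⁻ f (y ∷ xs) e x (there p) | false = countB-none⁻ f xs e x p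

countB-pos : {A : Set} (f : A → Bool) (xs : List A) → 0 < countB f xs → ∃[ x ] (x ∈ xs × f x ≡ true)
countB-pos f (y ∷ xs) p with f y in ey
... | true = y , here refl , ey
... | false with countB-pos f xs p
... | x , q , r = x , there q , r

countB-split : {A : Set} (f g : A → Bool) (xs : List A) → countB f xs ≡ countB (λ x → f x ∧ g x) xs + countB (λ x → f x ∧ not (g x)) xs
countB-split f g [] = refl
countB-split f g (x ∷ xs) with f x | g x
... | true | true = cong suc (countB-split f g xs)
... | true | false = trans (cong suc (countB-split f g xs)) (sym (+-suc _ _))
... | false | true = countB-split f g xs
... | false | false = countB-split f g xs

sumMap : {A : Set} → (A → ℕ) → List A → ℕ
sumMap g [] = 0
sumMap g (x ∷ xs) = g x + sumMap g xs

sumMap-cong : {A : Set} (f g : A → ℕ) (xs : List A) → (∀ x → x ∈ xs → f x ≡ g x) → sumMap f xs ≡ sumMap g xs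
sumMap-cong f g [] h = refl
sumMap-cong f g (x ∷ xs) h = cong₂ _+_ (h x (here refl)) (sumMap-cong f g xs (λ y p → h y (there p)))

sumMap-+ : {A : Set} (f g : A → ℕ) (xs : List A) → sumMap (λ x → f x + g x) xs ≡ sumMap f xs + sumMap g xs
sumMap-+ f g [] = refl
sumMap-+ f g (x ∷ xs) rewrite sumMap-+ f g xs = +-interchange (f x) (g x) (sumMap f xs) (sumMap g xs)

sumMap-indicator : {A : Set} (f : A → Bool) (K : ℕ) (xs : List A) → sumMap (λ x → if f x then K else 0) xs ≡ countB f xs * K
sumMap-indicator f K [] = refl
sumMap-indicator f K (x ∷ xs) with f x
... | true = cong (K +_) (sumMap-indicator f K xs)
... | false = sumMap-indicator f K xs

countB-concatMap : {A B : Set} (f : B → Bool) (h : A → List B) (xs : List A) →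
  countB f (concatMap h xs) ≡ sumMap (λ x → countB f (h x)) xs
countB-concatMap f h [] = refl
countB-concatMap f h (x ∷ xs) = trans (countB-++ f (h x) (concatMap h xs)) (cong (countB f (h x) +_) (countB-concatMap f h xs))

elem-∈ : ∀ {u} xs → elem u xs ≡ true → u ∈ xs
elem-∈ {u} (x ∷ xs) e with ∨-elim {u ≡ᵇ x} e
... | inj₁ p = here (≡ᵇ-true⁻ u x p)
... | inj₂ p = there (elem-∈ xs p)

∈-elem : ∀ {u} xs → u ∈ xs → elem u xs ≡ true
∈-elem {u} (x ∷ xs) (here refl) = ∨-introˡ (elem u xs) (≡ᵇ-true u u refl)
∈-elem {u} (x ∷ xs) (there p) = ∨-introʳ (u ≡ᵇ x) (∈-elem xs p)

elem-false : ∀ {u} xs → ¬ u ∈ xs → elem u xs ≡ false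
elem-false {u} xs ne with true-or-false (elem u xs)
... | inj₁ p = ⊥-elim (ne (elem-∈ xs p))
... | inj₂ p = p

elem-filterB : (f : ℕ → Bool) (xs : List ℕ) → ∀ {u} → u ∈ xs → elem u (filterB f xs) ≡ f u
elem-filterB f xs {u} p with true-or-false (f u)
... | inj₁ e rewrite e = ∈-elem (filterB f xs) (∈-filterB⁺ f xs p e)
... | inj₂ e rewrite e = elem-false (filterB f xs) (λ q → false≢true e (proj₂ (∈-filterB⁻ f xs q)))

consec : ℕ → ℕ → List ℕ
consec zero a = []
consec (suc c) a = a ∷ consec c (suc a)

consec-unique : (g : ℕ → ℕ → List ℕ) → (∀ x → g zero x ≡ []) → (∀ c x → g (suc c) x ≡ x ∷ g c (suc x)) →
  ∀ c x → g c x ≡ consec c x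
consec-unique g g-zero g-suc zero x = g-zero x
consec-unique g g-zero g-suc (suc c) x = trans (g-suc c x) (cong (x ∷_) (consec-unique g g-zero g-suc c (suc x)))

-- `range` recurses through a local function that cannot be named; it is identified with `consec`
-- through its recursion equations, generalising `suc a` so that unification can solve for it.
range≡consec : ∀ a b → range a b ≡ consec (suc b ∸ a) a
range≡consec a b = unfold-range (consec-unique _ (λ _ → refl) (λ _ _ → refl))
  where
  unfold-range : (∀ c x → _ ≡ consec c x) → range a b ≡ consec (suc b ∸ a) a
  unfold-range h with suc b ∸ a
  ... | zero = refl
  ... | suc c with suc a
  ... | a′ = cong (a ∷_) (h c a′)

∈-consec⁻ : ∀ c a {u} → u ∈ consec c a → a ≤ u × u < a + c
∈-consec⁻ (suc c) a (here refl) = ≤-refl , m<m+n a (s≤s z≤n)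
∈-consec⁻ (suc c) a {u} (there p) with ∈-consec⁻ c (suc a) p
... | q , r = <⇒≤ q , subst (u <_) (sym (+-suc a c)) r

∈-consec⁺ : ∀ c a {u} → a ≤ u → u < a + c → u ∈ consec c a
∈-consec⁺ zero a p q = ⊥-elim (<-irrefl refl (≤-trans q (≤-trans (≤-reflexive (+-identityʳ a)) p)))
∈-consec⁺ (suc c) a {u} p q with a ≟ u
... | yes refl = here refl
... | no ne = there (∈-consec⁺ c (suc a) (≤∧≢⇒< p ne) (subst (u <_) (+-suc a c) q))

∈-consec1⁻ : ∀ {N u} → u ∈ consec N 1 → 1 ≤ u × u ≤ N
∈-consec1⁻ {N} p with ∈-consec⁻ N 1 p
... | a , b = a , ≤-pred b

∈-consec1⁺ : ∀ {N u} → 1 ≤ u → u ≤ N → u ∈ consec N 1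
∈-consec1⁺ {N} a b = ∈-consec⁺ N 1 a (s≤s b)

length-consec : ∀ c a → length (consec c a) ≡ c
length-consec zero a = refl
length-consec (suc c) a = cong suc (length-consec c (suc a))

consec-+ : ∀ c1 c2 a → consec (c1 + c2) a ≡ consec c1 a ++ consec c2 (a + c1)
consec-+ zero c2 a = cong (λ z → consec c2 z) (sym (+-identityʳ a))
consec-+ (suc c1) c2 a = cong (a ∷_) (trans (consec-+ c1 c2 (suc a)) (cong (λ z → consec c1 (suc a) ++ consec c2 z) (sym (+-suc a c1))))

map-+-consec : ∀ d c a → map (_+ d) (consec c a) ≡ consec c (a + d)
map-+-consec d zero a = refl
map-+-consec d (suc c) a = cong ((a + d) ∷_) (map-+-consec d c (suc a))

at-∈ : ∀ xs z → z < length xs → at xs (suc z) ∈ xs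
at-∈ (x ∷ xs) zero _ = here refl
at-∈ (x ∷ xs) (suc z) (s≤s p) = there (at-∈ xs z p)

∈-at : ∀ xs {u} → u ∈ xs → ∃[ z ] (z < length xs × at xs (suc z) ≡ u)
∈-at (x ∷ xs) (here refl) = zero , s≤s z≤n , refl
∈-at (x ∷ xs) (there p) with ∈-at xs p
... | z , q , r = suc z , s≤s q , r

at-map : (f : ℕ → ℕ) (xs : List ℕ) → ∀ z → z < length xs → at (map f xs) (suc z) ≡ f (at xs (suc z))
at-map f (x ∷ xs) zero _ = refl
at-map f (x ∷ xs) (suc z) (s≤s p) = at-map f xs z p

at-++ˡ : (xs ys : List ℕ) → ∀ z → z < length xs → at (xs ++ ys) (suc z) ≡ at xs (suc z)
at-++ˡ (x ∷ xs) ys zero _ = refl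
at-++ˡ (x ∷ xs) ys (suc z) (s≤s p) = at-++ˡ xs ys z p

at-++-length : (xs ys : List ℕ) (y : ℕ) → at (xs ++ y ∷ ys) (suc (length xs)) ≡ y
at-++-length [] ys y = refl
at-++-length (x ∷ xs) ys y = at-++-length xs ys y

at-ext : (xs ys : List ℕ) → length xs ≡ length ys → (∀ z → z < length xs → at xs (suc z) ≡ at ys (suc z)) → xs ≡ ys
at-ext [] [] _ _ = refl
at-ext (x ∷ xs) (y ∷ ys) e h = cong₂ _∷_ (h zero (s≤s z≤n)) (at-ext xs ys (suc-injective e) (λ z p → h (suc z) (s≤s p)))

at-consec : ∀ c a y → y < c → at (consec c a) (suc y) ≡ a + y
at-consec (suc c) a zero _ = sym (+-identityʳ a)
at-consec (suc c) a (suc y) (s≤s p) = trans (at-consec c (suc a) y p) (sym (+-suc a y))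

map-at-consec-shift : ∀ x L c a → map (at (x ∷ L)) (consec c (suc (suc a))) ≡ map (at L) (consec c (suc a))
map-at-consec-shift x L zero a = refl
map-at-consec-shift x L (suc c) a = cong (at L (suc a) ∷_) (map-at-consec-shift x L c (suc a))

map-at-consec : ∀ L → map (at L) (consec (length L) 1) ≡ L
map-at-consec [] = refl
map-at-consec (x ∷ L) = cong (x ∷_) (trans (map-at-consec-shift x L (length L) 0) (map-at-consec L))

data Distinct : List ℕ → Set where
  distinct[] : Distinct []
  distinct∷ : ∀ {x xs} → ¬ x ∈ xs → Distinct xs → Distinct (x ∷ xs)

distinct-consec : ∀ c a → Distinct (consec c a)
distinct-consec zero a = distinct[]
distinct-consec (suc c) a = distinct∷ (λ p → <-irrefl refl (proj₁ (∈-consec⁻ c (suc a) p))) (distinct-consec c (suc a))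

distinct-filterB : (f : ℕ → Bool) → ∀ {xs} → Distinct xs → Distinct (filterB f xs)
distinct-filterB f distinct[] = distinct[]
distinct-filterB f {x ∷ xs} (distinct∷ ne nd) with f x
... | true = distinct∷ (λ p → ne (proj₁ (∈-filterB⁻ f xs p))) (distinct-filterB f nd)
... | false = distinct-filterB f nd

distinct-map : (f : ℕ → ℕ) → ∀ {xs} → (∀ x y → x ∈ xs → y ∈ xs → f x ≡ f y → x ≡ y) → Distinct xs → Distinct (map f xs)
distinct-map f h distinct[] = distinct[]
distinct-map f {x ∷ xs} h (distinct∷ ne nd) = distinct∷ fx∉ (distinct-map f (λ a c pa pc → h a c (there pa) (there pc)) nd)
  where fx∉ : ¬ f x ∈ map f xs
        fx∉ p with ∈-map⁻ f p
        ... | w , r , e = ne (subst (_∈ xs) (h w x (there r) (here refl) (sym e)) r)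

at-injective : ∀ {τ} → Distinct τ → ∀ z1 z2 → z1 < length τ → z2 < length τ → at τ (suc z1) ≡ at τ (suc z2) → z1 ≡ z2
at-injective {x ∷ τ} (distinct∷ ne nd) zero zero _ _ _ = refl
at-injective {x ∷ τ} (distinct∷ ne nd) zero (suc z2) _ (s≤s q) e = ⊥-elim (ne (subst (_∈ τ) (sym e) (at-∈ τ z2 q)))
at-injective {x ∷ τ} (distinct∷ ne nd) (suc z1) zero (s≤s p) _ e = ⊥-elim (ne (subst (_∈ τ) e (at-∈ τ z1 p)))
at-injective {x ∷ τ} (distinct∷ ne nd) (suc z1) (suc z2) (s≤s p) (s≤s q) e = cong suc (at-injective nd z1 z2 p q e)

countB-≡ᵇ-member : ∀ {xs} → Distinct xs → ∀ {x} → x ∈ xs → countB (λ w → w ≡ᵇ x) xs ≡ 1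
countB-≡ᵇ-member {y ∷ xs} (distinct∷ ne nd) {x} (here refl) rewrite ≡ᵇ-true x x refl =
  cong suc (countB-none _ xs (λ w p → ≡ᵇ-false w x (λ e → ne (subst (_∈ xs) e p))))
countB-≡ᵇ-member {y ∷ xs} (distinct∷ ne nd) {x} (there p) rewrite ≡ᵇ-false y x (λ e → ne (subst (_∈ xs) (sym e) p)) = countB-≡ᵇ-member nd p

countB-≡ᵇ-nonmember : ∀ xs {x} → ¬ x ∈ xs → countB (λ w → w ≡ᵇ x) xs ≡ 0
countB-≡ᵇ-nonmember xs {x} ne = countB-none _ xs (λ w p → ≡ᵇ-false w x (λ e → ne (subst (_∈ xs) e p)))

countB-restrict : (meshP : ℕ → Bool) → ∀ {L} → Distinct L → ∀ {R} → Distinct R → (∀ u → u ∈ L → u ∈ R) →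
  countB meshP L ≡ countB (λ u → meshP u ∧ elem u L) R
countB-restrict meshP {[]} distinct[] {R} ndR h = sym (trans (countB-ext _ _ R (λ u → ∧-falseʳ (meshP u) refl)) (countB-false R))
countB-restrict meshP {x ∷ L} (distinct∷ ne nd) {R} ndR h =
  trans step (sym (trans (countB-split (λ u → meshP u ∧ elem u (x ∷ L)) (λ u → u ≡ᵇ x) R)
                         (cong₂ _+_ (trans (countB-ext _ _ R e1) first) (countB-ext _ _ R e2))))
  where
  IH = countB-restrict meshP nd ndR (λ u p → h u (there p))
  first : countB (λ u → meshP x ∧ (u ≡ᵇ x)) R ≡ (if meshP x then 1 else 0)
  first with meshP x
  ... | true = countB-≡ᵇ-member ndR (h x (here refl))
  ... | false = countB-false R
  e1 : ∀ u → ((meshP u ∧ elem u (x ∷ L)) ∧ (u ≡ᵇ x)) ≡ (meshP x ∧ (u ≡ᵇ x))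
  e1 u with u ≡ᵇ x in eq
  ... | false = trans (∧-falseʳ _ refl) (sym (∧-falseʳ _ refl))
  ... | true rewrite ≡ᵇ-true⁻ u x eq with meshP x
  ... | true = refl
  ... | false = refl
  e2 : ∀ u → ((meshP u ∧ elem u (x ∷ L)) ∧ not (u ≡ᵇ x)) ≡ (meshP u ∧ elem u L)
  e2 u with u ≡ᵇ x in eq
  ... | true rewrite ≡ᵇ-true⁻ u x eq | elem-false L ne = trans (∧-falseʳ _ refl) (sym (∧-falseʳ (meshP x) refl))
  ... | false with meshP u
  ... | true = ∧-identityʳ _
  ... | false = refl
  step : countB meshP (x ∷ L) ≡ (if meshP x then 1 else 0) + countB (λ u → meshP u ∧ elem u L) R
  step with meshP x
  ... | true = cong suc IH
  ... | false = IH

data Increasing : List ℕ → Set where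
  inc[] : Increasing []
  inc∷ : ∀ {x xs} → (∀ y → y ∈ xs → x < y) → Increasing xs → Increasing (x ∷ xs)

increasing-consec : ∀ c a → Increasing (consec c a)
increasing-consec zero a = inc[]
increasing-consec (suc c) a = inc∷ (λ y p → proj₁ (∈-consec⁻ c (suc a) p)) (increasing-consec c (suc a))

increasing-filterB : (f : ℕ → Bool) → ∀ {xs} → Increasing xs → Increasing (filterB f xs)
increasing-filterB f inc[] = inc[]
increasing-filterB f {x ∷ xs} (inc∷ h s) with f x
... | true = inc∷ (λ y p → h y (proj₁ (∈-filterB⁻ f xs p))) (increasing-filterB f s)
... | false = increasing-filterB f s

increasing-++ : ∀ {xs ys} → Increasing xs → Increasing ys → (∀ x y → x ∈ xs → y ∈ ys → x < y) → Increasing (xs ++ ys)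
increasing-++ inc[] t h = t
increasing-++ {x ∷ xs} {ys} (inc∷ h1 s) t h = inc∷ hh (increasing-++ s t (λ a b p q → h a b (there p) q))
  where hh : ∀ y → y ∈ xs ++ ys → x < y
        hh y p with ∈-++⁻ xs p
        ... | inj₁ q = h1 y q
        ... | inj₂ q = h x y (here refl) q

increasing-sentinels : ∀ {N xs} → Increasing xs → (∀ u → u ∈ xs → u ∈ consec N 1) → Increasing (0 ∷ xs ++ (suc N ∷ []))
increasing-sentinels {N} {xs} inc xs⊆ = inc∷ positive (increasing-++ inc (inc∷ (λ y ()) inc[]) below-suc-N)
  where
  below-suc-N : ∀ x y → x ∈ xs → y ∈ suc N ∷ [] → x < y
  below-suc-N x y x∈ (here refl) = s≤s (proj₂ (∈-consec1⁻ (xs⊆ x x∈)))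
  positive : ∀ y → y ∈ xs ++ (suc N ∷ []) → 0 < y
  positive y p with ∈-++⁻ xs p
  ... | inj₁ q = proj₁ (∈-consec1⁻ (xs⊆ y q))
  ... | inj₂ (here refl) = s≤s z≤n

at-sentinels-≤ : ∀ {N xs} → (∀ u → u ∈ xs → u ∈ consec N 1) → ∀ z → at (0 ∷ xs ++ (suc N ∷ [])) z ≤ suc N
at-sentinels-≤ {N} {xs} xs⊆ = at-≤ (0 ∷ xs ++ (suc N ∷ [])) bounded
  where
  at-≤ : ∀ ys → (∀ y → y ∈ ys → y ≤ suc N) → ∀ z → at ys z ≤ suc N
  at-≤ [] h z = z≤n
  at-≤ (y ∷ ys) h zero = z≤n
  at-≤ (y ∷ ys) h (suc zero) = h y (here refl)
  at-≤ (y ∷ ys) h (suc (suc z)) = at-≤ ys (λ y p → h y (there p)) (suc z)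
  bounded : ∀ u → u ∈ 0 ∷ xs ++ (suc N ∷ []) → u ≤ suc N
  bounded u (here refl) = z≤n
  bounded u (there p) with ∈-++⁻ xs p
  ... | inj₁ q = m≤n⇒m≤1+n (proj₂ (∈-consec1⁻ (xs⊆ u q)))
  ... | inj₂ (here refl) = ≤-refl

at-mono-< : ∀ {xs} → Increasing xs → ∀ z1 z2 → z1 < z2 → z2 < length xs → at xs (suc z1) < at xs (suc z2)
at-mono-< {x ∷ xs} (inc∷ h s) zero (suc z2) _ (s≤s q) = h _ (at-∈ xs z2 q)
at-mono-< {x ∷ xs} (inc∷ h s) (suc z1) (suc z2) (s≤s p) (s≤s q) = at-mono-< s z1 z2 p q

at-mono≤ : ∀ {xs} → Increasing xs → ∀ z1 z2 → z1 ≤ z2 → z2 < length xs → at xs (suc z1) ≤ at xs (suc z2)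
at-mono≤ s z1 z2 p q with m≤n⇒m<n∨m≡n p
... | inj₁ r = <⇒≤ (at-mono-< s z1 z2 r q)
... | inj₂ refl = ≤-refl

increasing-gap-empty : ∀ {ys} → Increasing ys → ∀ {u} → u ∈ ys → ∀ y → suc y < length ys →
  at ys (suc y) < u → u < at ys (suc (suc y)) → ⊥
increasing-gap-empty {ys} inc u∈ y y< lo hi with ∈-at ys u∈
... | w , w< , refl with ≤-<-connex w y
... | inj₁ w≤y = <-irrefl refl (<-≤-trans lo (at-mono≤ inc w y w≤y (<-trans (n<1+n y) y<)))
... | inj₂ y<w = <-irrefl refl (<-≤-trans hi (at-mono≤ inc (suc y) w y<w w<))

bracket : ∀ {m} h L → Increasing (h ∷ L) → h < m → ¬ m ∈ L → ∀ {w} → w ∈ L → m < w →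
  ∃[ x ] (x < length L × at (h ∷ L) (suc x) < m × m < at (h ∷ L) (suc (suc x)))
bracket {m} h (y ∷ L) (inc∷ hh s) hm notin {w} win mw with <-cmp m y
... | tri< a _ _ = zero , s≤s z≤n , hm , a
... | tri≈ _ b _ = ⊥-elim (notin (here b))
... | tri> _ _ c with win
... | here refl = ⊥-elim (<-asym mw c)
... | there win' with bracket y L s c (λ p → notin (there p)) win' mw
... | x , p , q , r = suc x , s≤s p , q , r

covers : ℕ → (ℕ → Bool) → List ℕ → Bool
covers N d τ = all (λ v → not (d v) ∨ elem v τ) (consec N 1)

without : (ℕ → Bool) → ℕ → ℕ → Bool
without d v w = d w ∧ not (w ≡ᵇ v)

covers-∷ : ∀ N d v τ → covers N d (v ∷ τ) ≡ covers N (without d v) τ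
covers-∷ N d v τ = all-cong _ _ (consec N 1) pt
  where
  pt : ∀ w → (not (d w) ∨ ((w ≡ᵇ v) ∨ elem w τ)) ≡ (not (d w ∧ not (w ≡ᵇ v)) ∨ elem w τ)
  pt w with d w | w ≡ᵇ v
  ... | true | true = refl
  ... | true | false = refl
  ... | false | _ = refl

countB-≡ᵇ≤1 : ∀ {xs} → Distinct xs → ∀ v → countB (λ w → w ≡ᵇ v) xs ≤ 1
countB-≡ᵇ≤1 {xs} nd v with true-or-false (elem v xs)
... | inj₁ p = ≤-reflexive (countB-≡ᵇ-member nd (elem-∈ xs p))
... | inj₂ p = ≤-trans (≤-reflexive (countB-≡ᵇ-nonmember xs (λ q → false≢true p (∈-elem xs q)))) z≤n

countB-without : ∀ N d v → countB d (consec N 1) ≤ suc (countB (without d v) (consec N 1))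
countB-without N d v = begin
    countB d (consec N 1)
  ≡⟨ countB-split d (λ w → w ≡ᵇ v) (consec N 1) ⟩
    countB (λ w → d w ∧ (w ≡ᵇ v)) (consec N 1) + countB (without d v) (consec N 1)
  ≤⟨ +-monoˡ-≤ _ (≤-trans (countB-mono _ _ (consec N 1) (λ w _ e → ∧-elimʳ {d w} e)) (countB-≡ᵇ≤1 (distinct-consec N 1) v)) ⟩
    suc (countB (without d v) (consec N 1))
  ∎
  where open ≤-Reasoning

covers⇒count≤length : ∀ N d τ → covers N d τ ≡ true → countB d (consec N 1) ≤ length τ
covers⇒count≤length N d [] c = ≤-reflexive (countB-none d (consec N 1) (λ w p → pt (all-elim _ (consec N 1) c p)))
  where
  pt : ∀ {w} → (not (d w) ∨ false) ≡ true → d w ≡ false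
  pt {w} e with d w
  ... | false = refl
  pt {w} () | true
covers⇒count≤length N d (v ∷ τ) c = ≤-trans (countB-without N d v) (s≤s (covers⇒count≤length N (without d v) τ (trans (sym (covers-∷ N d v τ)) c)))

covers-tight : ∀ N d τ → covers N d τ ≡ true → countB d (consec N 1) ≡ length τ →
  Distinct τ × (∀ v → v ∈ τ → d v ≡ true × v ∈ consec N 1)
covers-tight N d [] c e = distinct[] , (λ v ())
covers-tight N d (v ∷ τ) c e = distinct∷ notin ndτ , allv
  where
  c' = trans (sym (covers-∷ N d v τ)) c
  B≤ = covers⇒count≤length N (without d v) τ c'
  A = countB (λ w → d w ∧ (w ≡ᵇ v)) (consec N 1)
  A≤ : A ≤ 1
  A≤ = ≤-trans (countB-mono _ _ (consec N 1) (λ w _ e → ∧-elimʳ {d w} e)) (countB-≡ᵇ≤1 (distinct-consec N 1) v)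
  sp : A + countB (without d v) (consec N 1) ≡ suc (length τ)
  sp = trans (sym (countB-split d (λ w → w ≡ᵇ v) (consec N 1))) e
  A≡ : A ≡ 1
  A≡ = ≤-antisym A≤ (≤-pred′ (≤-trans (≤-reflexive (sym sp)) (≤-trans (+-monoʳ-≤ A B≤) (≤-reflexive (+-comm A (length τ))))))
    where ≤-pred′ : ∀ {a b} → suc b ≤ b + a → 1 ≤ a
          ≤-pred′ {zero} {b} p = ⊥-elim (<-irrefl refl (≤-trans p (≤-reflexive (+-identityʳ b))))
          ≤-pred′ {suc a} p = s≤s z≤n
  B≡ : countB (without d v) (consec N 1) ≡ length τ
  B≡ = suc-injective (trans (cong (_+ countB (without d v) (consec N 1)) (sym A≡)) sp)
  IH = covers-tight N (without d v) τ c' B≡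
  ndτ = proj₁ IH
  notin : ¬ v ∈ τ
  notin p = false≢true (∧-falseʳ (d v) (cong not (≡ᵇ-true v v refl))) (proj₁ (proj₂ IH v p))
  wit = countB-pos _ (consec N 1) (subst (0 <_) (sym A≡) (s≤s z≤n))
  vin : d v ≡ true × v ∈ consec N 1
  vin with wit
  ... | w , p , q with ≡ᵇ-true⁻ w v (∧-elimʳ {d w} q)
  ... | refl = ∧-elimˡ q , p
  allv : ∀ u → u ∈ v ∷ τ → d u ≡ true × u ∈ consec N 1
  allv u (here refl) = vin
  allv u (there p) with proj₂ IH u p
  ... | q , r = ∧-elimˡ q , r

record PermutationFacts (N : ℕ) (τ : List ℕ) : Set where
  field
    length≡ : length τ ≡ N
    distinct : Distinct τ
    ⊆consec : ∀ v → v ∈ τ → v ∈ consec N 1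
    ⊇consec : ∀ v → v ∈ consec N 1 → v ∈ τ

isPerm⇒facts : ∀ N τ → isPerm N τ ≡ true → PermutationFacts N τ
isPerm⇒facts N τ e = record { length≡ = L ; distinct = proj₁ TT ; ⊆consec = λ v p → proj₂ (proj₂ TT v p) ; ⊇consec = cv }
  where
  L : length τ ≡ N
  L = ≡ᵇ-true⁻ _ _ (∧-elimˡ e)
  C : covers N (λ _ → true) τ ≡ true
  C = trans (sym (cong (all (λ v → elem v τ)) (range≡consec 1 N))) (∧-elimʳ {length τ ≡ᵇ N} e)
  TT = covers-tight N (λ _ → true) τ C (trans (countB-true (consec N 1)) (trans (length-consec N 1) (sym L)))
  cv : ∀ v → v ∈ consec N 1 → v ∈ τ
  cv v p = elem-∈ τ (all-elim _ (consec N 1) C p)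

allLists-length : ∀ N m τ → τ ∈ allLists N m → length τ ≡ m
allLists-length N zero .[] (here refl) = refl
allLists-length N (suc m) τ p with find (∈-concatMap⁻ (λ v → map (v ∷_) (allLists N m)) {xs = range 1 N} p)
... | v , _ , q with ∈-map⁻ (v ∷_) q
... | zs , r , refl = cong suc (allLists-length N m zs r)

countB-allLists-suc : ∀ N m (f : List ℕ → Bool) →
  countB f (allLists N (suc m)) ≡ sumMap (λ v → countB (λ τ → f (v ∷ τ)) (allLists N m)) (consec N 1)
countB-allLists-suc N m f = begin
    countB f (concatMap (λ v → map (v ∷_) (allLists N m)) (range 1 N))
  ≡⟨ cong (λ z → countB f (concatMap (λ v → map (v ∷_) (allLists N m)) z)) (range≡consec 1 N) ⟩
    countB f (concatMap (λ v → map (v ∷_) (allLists N m)) (consec N 1))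
  ≡⟨ countB-concatMap f _ (consec N 1) ⟩
    sumMap (λ v → countB f (map (v ∷_) (allLists N m))) (consec N 1)
  ≡⟨ sumMap-cong _ _ (consec N 1) (λ v _ → countB-map f (v ∷_) (allLists N m)) ⟩
    sumMap (λ v → countB (λ τ → f (v ∷ τ)) (allLists N m)) (consec N 1)
  ∎
  where open ≡-Reasoning

choose-length : ∀ xs k ys → ys ∈ choose xs k → length ys ≡ k
choose-length xs zero .[] (here refl) = refl
choose-length (x ∷ xs) (suc k) ys p with ∈-++⁻ (map (x ∷_) (choose xs k)) p
... | inj₁ q with ∈-map⁻ (x ∷_) q
... | zs , r , refl = cong suc (choose-length xs k zs r)
choose-length (x ∷ xs) (suc k) ys p | inj₂ q = choose-length xs (suc k) ys q

choose-⊆ : ∀ xs k ys → ys ∈ choose xs k → ∀ y → y ∈ ys → y ∈ xs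
choose-⊆ xs zero .[] (here refl) y ()
choose-⊆ (x ∷ xs) (suc k) ys p y yin with ∈-++⁻ (map (x ∷_) (choose xs k)) p
... | inj₁ q with ∈-map⁻ (x ∷_) q
... | zs , r , refl with yin
... | here refl = here refl
... | there yin' = there (choose-⊆ xs k zs r y yin')
choose-⊆ (x ∷ xs) (suc k) ys p y yin | inj₂ q = there (choose-⊆ xs (suc k) ys q y yin)

choose≡filterB : ∀ xs → Distinct xs → ∀ k ys → ys ∈ choose xs k → ys ≡ filterB (λ m → elem m ys) xs
choose≡filterB xs nd zero .[] (here refl) = sym (fbf xs)
  where fbf : ∀ xs → filterB (λ m → elem m []) xs ≡ []
        fbf [] = refl
        fbf (x ∷ xs) = fbf xs
choose≡filterB (x ∷ xs) (distinct∷ ne nd) (suc k) ys p with ∈-++⁻ (map (x ∷_) (choose xs k)) p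
... | inj₁ q with ∈-map⁻ (x ∷_) q
... | zs , r , refl rewrite ≡ᵇ-true x x refl =
  cong (x ∷_) (trans (choose≡filterB xs nd k zs r) (filterB-cong _ _ xs (λ m mi → sym (cong (_∨ elem m zs) (≡ᵇ-false m x (λ e → ne (subst (_∈ xs) e mi)))))))
choose≡filterB (x ∷ xs) (distinct∷ ne nd) (suc k) ys p | inj₂ q
  rewrite elem-false ys (λ xin → ne (choose-⊆ xs (suc k) ys q x xin)) = choose≡filterB xs nd (suc k) ys q

-- With D = n ∸ k, the "extreme" values of [1, n] are those ≤ i or > D + i; `inflate` is the
-- increasing bijection from [1, k] onto them, so π↑ is π written in the extreme values.
module MeshCount (n k i j : ℕ) (π : List ℕ) where

  D : ℕ
  D = n ∸ k

  extreme : ℕ → Bool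
  extreme v = (v <ᵇ suc i) ∨ (D + i <ᵇ v)

  inflate : ℕ → ℕ
  inflate x = if x <ᵇ suc i then x else x + D

  π↑ : List ℕ
  π↑ = map inflate π

  extreme-low : ∀ {v} → v ≤ i → extreme v ≡ true
  extreme-low {v} p = ∨-introˡ _ (<ᵇ-true v (suc i) (s≤s p))
  extreme-high : ∀ {v} → D + i < v → extreme v ≡ true
  extreme-high {v} p = ∨-introʳ (v <ᵇ suc i) (<ᵇ-true (D + i) v p)
  not-extreme : ∀ {v} → i < v → v ≤ D + i → extreme v ≡ false
  not-extreme {v} p q rewrite <ᵇ-false v (suc i) p | <ᵇ-false (D + i) v q = refl
  extreme⁻ : ∀ {v} → extreme v ≡ true → v ≤ i ⊎ D + i < v
  extreme⁻ {v} e with ∨-elim {v <ᵇ suc i} e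
  ... | inj₁ p = inj₁ (≤-pred (<ᵇ-true⁻ v (suc i) p))
  ... | inj₂ p = inj₂ (<ᵇ-true⁻ (D + i) v p)
  not-extreme⁻ : ∀ {v} → extreme v ≡ false → i < v × v ≤ D + i
  not-extreme⁻ {v} e with v <ᵇ suc i in e1 | D + i <ᵇ v in e2
  not-extreme⁻ {v} () | true | _
  not-extreme⁻ {v} () | false | true
  ... | false | false = <ᵇ-false⁻ v (suc i) e1 , <ᵇ-false⁻ (D + i) v e2

  inflate-low : ∀ {x} → x ≤ i → inflate x ≡ x
  inflate-low {x} p rewrite <ᵇ-true x (suc i) (s≤s p) = refl
  inflate-high : ∀ {x} → i < x → inflate x ≡ x + D
  inflate-high {x} p rewrite <ᵇ-false x (suc i) p = refl

  inflate-suc : ∀ y → ¬ y ≡ i → inflate (suc y) ≡ suc (inflate y)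
  inflate-suc y ne with <-cmp y i
  ... | tri< a _ _ = trans (inflate-low a) (cong suc (sym (inflate-low (<⇒≤ a))))
  ... | tri≈ _ b _ = ⊥-elim (ne b)
  ... | tri> _ _ c = trans (inflate-high (m<n⇒m<1+n c)) (cong suc (sym (inflate-high c)))

  inflate-extreme : ∀ x → extreme (inflate x) ≡ true
  inflate-extreme x with ≤-<-connex x i
  ... | inj₁ p rewrite inflate-low p = extreme-low p
  ... | inj₂ p rewrite inflate-high p = extreme-high (subst (_< x + D) (+-comm i D) (+-monoˡ-< D p))

  inflate-mono-< : ∀ {x y} → x < y → inflate x < inflate y
  inflate-mono-< {x} {y} p with ≤-<-connex x i | ≤-<-connex y i
  ... | inj₁ a | inj₁ b rewrite inflate-low a | inflate-low b = p
  ... | inj₁ a | inj₂ b rewrite inflate-low a | inflate-high b = ≤-trans p (m≤m+n y D)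
  ... | inj₂ a | inj₁ b = ⊥-elim (<-irrefl refl (<-trans a (<-≤-trans p b)))
  ... | inj₂ a | inj₂ b rewrite inflate-high a | inflate-high b = +-monoˡ-< D p

  inflate-mono-≤ : ∀ {x y} → x ≤ y → inflate x ≤ inflate y
  inflate-mono-≤ {x} {y} p with m≤n⇒m<n∨m≡n p
  ... | inj₁ q = <⇒≤ (inflate-mono-< q)
  ... | inj₂ refl = ≤-refl

  inflate-<ᵇ : ∀ x y → (inflate x <ᵇ inflate y) ≡ (x <ᵇ y)
  inflate-<ᵇ x y with true-or-false (x <ᵇ y)
  ... | inj₁ e rewrite e = <ᵇ-true _ _ (inflate-mono-< (<ᵇ-true⁻ x y e))
  ... | inj₂ e rewrite e = <ᵇ-false _ _ (inflate-mono-≤ (<ᵇ-false⁻ x y e))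

  inflate-injective : ∀ {x y} → inflate x ≡ inflate y → x ≡ y
  inflate-injective {x} {y} e with <-cmp x y
  ... | tri< a _ _ = ⊥-elim (<-irrefl e (inflate-mono-< a))
  ... | tri≈ _ b _ = b
  ... | tri> _ _ c = ⊥-elim (<-irrefl (sym e) (inflate-mono-< c))

  -- Reads τ from left to right: r lists the extreme values still expected (in this order)
  -- and t counts those already read; a middle value is rejected exactly when t = j.
  accepts : ℕ → List ℕ → List ℕ → Bool
  accepts t [] [] = true
  accepts t (x ∷ r) [] = false
  accepts t [] (v ∷ τ) = if extreme v then false else (not (t ≡ᵇ j) ∧ accepts t [] τ)
  accepts t (x ∷ r) (v ∷ τ) = if extreme v then ((v ≡ᵇ x) ∧ accepts (suc t) r τ) else (not (t ≡ᵇ j) ∧ accepts t (x ∷ r) τ)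

  accepts-extreme-[] : ∀ t v τ → extreme v ≡ true → accepts t [] (v ∷ τ) ≡ false
  accepts-extreme-[] t v τ e rewrite e = refl

  accepts-extreme-∷ : ∀ t x r v τ → extreme v ≡ true → accepts t (x ∷ r) (v ∷ τ) ≡ ((v ≡ᵇ x) ∧ accepts (suc t) r τ)
  accepts-extreme-∷ t x r v τ e rewrite e = refl

  accepts-middle : ∀ t r v τ → extreme v ≡ false → accepts t r (v ∷ τ) ≡ (not (t ≡ᵇ j) ∧ accepts t r τ)
  accepts-middle t [] v τ e rewrite e = refl
  accepts-middle t (x ∷ r) v τ e rewrite e = refl

  -- The number of words accepted from state t that use c given middle values and s expected extreme values.
  acceptCount : ℕ → ℕ → ℕ → ℕ
  acceptCount zero zero t = 1
  acceptCount (suc c) zero t = if t ≡ᵇ j then 0 else suc c * acceptCount c zero t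
  acceptCount zero (suc s) t = acceptCount zero s (suc t)
  acceptCount (suc c) (suc s) t = (if t ≡ᵇ j then 0 else suc c * acceptCount c (suc s) t) + acceptCount (suc c) s (suc t)

  countAccepting : ℕ → (ℕ → Bool) → ℕ → List ℕ → ℕ
  countAccepting m d t r = countB (λ τ → covers n d τ ∧ accepts t r τ) (allLists n m)

  -- The words counted by countAccepting m d t r are those of length m containing every value
  -- demanded by d; under this invariant they must be permutations of the demanded values.
  record Demand (d : ℕ → Bool) (r : List ℕ) (c : ℕ) : Set where
    field
      demand-extreme : ∀ v → v ∈ consec n 1 → extreme v ≡ true → d v ≡ elem v r
      demand-middle : countB (λ v → d v ∧ not (extreme v)) (consec n 1) ≡ c
      pending-distinct : Distinct r
      pending-extreme : ∀ v → v ∈ r → v ∈ consec n 1 × extreme v ≡ true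

  isHead : List ℕ → ℕ → Bool
  isHead [] v = false
  isHead (x ∷ r) v = v ≡ᵇ x

  middleTerm : ℕ → ℕ → ℕ → ℕ
  middleTerm zero s t = 0
  middleTerm (suc c) s t = if t ≡ᵇ j then 0 else acceptCount c s t

  extremeTerm : ℕ → List ℕ → ℕ → ℕ
  extremeTerm c [] t = 0
  extremeTerm c (x ∷ r) t = acceptCount c (length r) (suc t)

  countB-extreme-pending : ∀ {r} → Distinct r → (∀ v → v ∈ r → v ∈ consec n 1 × extreme v ≡ true) → countB (λ v → extreme v ∧ elem v r) (consec n 1) ≡ length r
  countB-extreme-pending {r} nd h = trans (sym (countB-restrict extreme nd (distinct-consec n 1) (λ u p → proj₁ (h u p))))
                             (trans (countB-cong extreme (λ _ → true) r (λ u p → proj₂ (h u p))) (countB-true r))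

  demand-total : ∀ {d r c} → Demand d r c → countB d (consec n 1) ≡ c + length r
  demand-total {d} {r} {c} I = begin
      countB d (consec n 1)
    ≡⟨ countB-split d (λ v → not (extreme v)) (consec n 1) ⟩
      countB (λ v → d v ∧ not (extreme v)) (consec n 1) + countB (λ v → d v ∧ not (not (extreme v))) (consec n 1)
    ≡⟨ cong₂ _+_ (Demand.demand-middle I) (countB-cong _ _ (consec n 1) pt) ⟩
      c + countB (λ v → extreme v ∧ elem v r) (consec n 1)
    ≡⟨ cong (c +_) (countB-extreme-pending (Demand.pending-distinct I) (Demand.pending-extreme I)) ⟩
      c + length r
    ∎
    where
    open ≡-Reasoning
    pt : ∀ v → v ∈ consec n 1 → (d v ∧ not (not (extreme v))) ≡ (extreme v ∧ elem v r)
    pt v p with extreme v in ev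
    ... | true rewrite Demand.demand-extreme I v p ev = ∧-identityʳ _
    ... | false = ∧-falseʳ (d v) refl

  demand-extreme-step : ∀ {d x r c} → Demand d (x ∷ r) c → Demand (without d x) r c
  demand-extreme-step {d} {x} {r} {c} I = record { demand-extreme = extreme-ok ; demand-middle = trans (countB-ext _ _ (consec n 1) middle-same) (Demand.demand-middle I) ; pending-distinct = r-distinct ; pending-extreme = λ v p → Demand.pending-extreme I v (there p) }
    where
    x∉r : ¬ x ∈ r
    x∉r with Demand.pending-distinct I
    ... | distinct∷ q _ = q
    r-distinct : Distinct r
    r-distinct with Demand.pending-distinct I
    ... | distinct∷ _ q = q
    extreme-ok : ∀ v → v ∈ consec n 1 → extreme v ≡ true → without d x v ≡ elem v r
    extreme-ok v p e rewrite Demand.demand-extreme I v p e with v ≡ᵇ x in eq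
    ... | true rewrite ≡ᵇ-true⁻ v x eq = sym (elem-false r x∉r)
    ... | false = ∧-identityʳ _
    middle-same : ∀ v → (without d x v ∧ not (extreme v)) ≡ (d v ∧ not (extreme v))
    middle-same v with v ≡ᵇ x in eq
    ... | true rewrite ≡ᵇ-true⁻ v x eq | proj₂ (Demand.pending-extreme I x (here refl)) = trans (∧-falseʳ _ refl) (sym (∧-falseʳ (d x) refl))
    ... | false rewrite ∧-identityʳ (d v) = refl

  demand-middle-step : ∀ {d r c v} → Demand d r (suc c) → v ∈ consec n 1 → extreme v ≡ false → d v ≡ true → Demand (without d v) r c
  demand-middle-step {d} {r} {c} {v} I vin ev dv = record { demand-extreme = extreme-ok ; demand-middle = middle-count ; pending-distinct = Demand.pending-distinct I ; pending-extreme = Demand.pending-extreme I }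
    where
    extreme-ok : ∀ w → w ∈ consec n 1 → extreme w ≡ true → without d v w ≡ elem w r
    extreme-ok w p e with w ≡ᵇ v in eq
    ... | true rewrite ≡ᵇ-true⁻ w v eq = ⊥-elim (false≢true ev e)
    ... | false = trans (∧-identityʳ _) (Demand.demand-extreme I w p e)
    middle-demanded = λ w → d w ∧ not (extreme w)
    v-counted-once : countB (λ w → middle-demanded w ∧ (w ≡ᵇ v)) (consec n 1) ≡ 1
    v-counted-once = trans (countB-ext _ _ (consec n 1) pt) (countB-≡ᵇ-member (distinct-consec n 1) vin)
      where
      pt : ∀ w → (middle-demanded w ∧ (w ≡ᵇ v)) ≡ (w ≡ᵇ v)
      pt w with w ≡ᵇ v in eq
      ... | false = ∧-falseʳ _ refl
      ... | true rewrite ≡ᵇ-true⁻ w v eq | dv | ev = refl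
    middle-count : countB (λ w → without d v w ∧ not (extreme w)) (consec n 1) ≡ c
    middle-count = suc-injective (trans (cong suc (sym (countB-ext _ _ (consec n 1) (λ w → ∧-swapʳ (d w) (not (extreme w)) (not (w ≡ᵇ v))))))
           (trans (cong (_+ countB (λ w → middle-demanded w ∧ not (w ≡ᵇ v)) (consec n 1)) (sym v-counted-once))
             (trans (sym (countB-split middle-demanded (λ w → w ≡ᵇ v) (consec n 1))) (Demand.demand-middle I))))

  CountHyp : ℕ → Set
  CountHyp m = ∀ d t r c → Demand d r c → c + length r ≡ m → countAccepting m d t r ≡ acceptCount c (length r) t

  countAccepting-extreme-first : ∀ m d t r c → Demand d r c → c + length r ≡ suc m → CountHyp m →
    ∀ v → extreme v ≡ true →
    countB (λ τ → covers n (without d v) τ ∧ accepts t r (v ∷ τ)) (allLists n m) ≡ (if isHead r v then extremeTerm c r t else 0)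
  countAccepting-extreme-first m d t [] c I e IH v ev =
    countB-none _ (allLists n m) (λ τ _ → ∧-falseʳ _ (accepts-extreme-[] t v τ ev))
  countAccepting-extreme-first m d t (x ∷ r) c I e IH v ev with v ≡ᵇ x in v≡ᵇx
  ... | false = countB-none _ (allLists n m) (λ τ _ → ∧-falseʳ _ (if-true (extreme v) _ _ ev))
  ... | true with ≡ᵇ-true⁻ v x v≡ᵇx
  ... | refl = trans (countB-ext _ _ (allLists n m) (λ τ → cong (covers n (without d x) τ ∧_) (if-true (extreme x) _ _ ev)))
                     (IH (without d x) (suc t) r c (demand-extreme-step I) (suc-injective (trans (sym (+-suc c (length r))) e)))

  middleTerm-at-j : ∀ c s t → (t ≡ᵇ j) ≡ true → middleTerm c s t ≡ 0
  middleTerm-at-j zero s t _ = refl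
  middleTerm-at-j (suc c) s t t≡ᵇj rewrite t≡ᵇj = refl

  countAccepting-middle-first : ∀ m d t r c → Demand d r c → c + length r ≡ suc m → CountHyp m →
    ∀ v → v ∈ consec n 1 → extreme v ≡ false →
    countB (λ τ → covers n (without d v) τ ∧ accepts t r (v ∷ τ)) (allLists n m) ≡ (if d v then middleTerm c (length r) t else 0)
  countAccepting-middle-first m d t r c I e IH v vin ev =
    trans (countB-ext _ _ (allLists n m) (λ τ → cong (covers n (without d v) τ ∧_) (accepts-middle t r v τ ev))) by-cases
    where
    by-cases : countB (λ τ → covers n (without d v) τ ∧ (not (t ≡ᵇ j) ∧ accepts t r τ)) (allLists n m)
             ≡ (if d v then middleTerm c (length r) t else 0)
    by-cases with t ≡ᵇ j in t≡ᵇj | d v in dv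
    ... | true | true = trans (countB-none _ (allLists n m) (λ τ _ → ∧-zeroʳ _)) (sym (middleTerm-at-j c (length r) t t≡ᵇj))
    ... | true | false = countB-none _ (allLists n m) (λ τ _ → ∧-zeroʳ _)
    ... | false | true = demanded c I e
      where
      demanded : ∀ c → Demand d r c → c + length r ≡ suc m → countAccepting m (without d v) t r ≡ middleTerm c (length r) t
      demanded zero I _ = ⊥-elim (false≢true (countB-none⁻ _ (consec n 1) (Demand.demand-middle I) v vin) (cong₂ (λ a b → a ∧ not b) dv ev))
      demanded (suc c) I e rewrite t≡ᵇj = IH (without d v) t r c (demand-middle-step I vin ev dv) (suc-injective e)
    ... | false | false = countB-none _ (allLists n m) uncoverable
      where
      without≡ : countB (without d v) (consec n 1) ≡ suc m
      without≡ = trans (countB-ext _ _ (consec n 1) same) (trans (demand-total I) e)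
        where
        same : ∀ w → without d v w ≡ d w
        same w with w ≡ᵇ v in eq
        ... | true rewrite ≡ᵇ-true⁻ w v eq = trans (cong (_∧ false) dv) (sym dv)
        ... | false = ∧-identityʳ _
      uncoverable : ∀ τ → τ ∈ allLists n m → (covers n (without d v) τ ∧ accepts t r τ) ≡ false
      uncoverable τ τin with covers n (without d v) τ in cov
      ... | false = refl
      ... | true = ⊥-elim (<-irrefl refl (≤-trans (≤-reflexive (sym without≡))
                     (≤-trans (covers⇒count≤length n (without d v) τ cov) (≤-reflexive (allLists-length n m τ τin)))))

  isHead-middle : ∀ {r} → (∀ v → v ∈ r → v ∈ consec n 1 × extreme v ≡ true) → ∀ {v} → extreme v ≡ false → isHead r v ≡ false
  isHead-middle {[]} h ev = refl
  isHead-middle {x ∷ r} h {v} ev with v ≡ᵇ x in v≡ᵇx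
  ... | false = refl
  ... | true rewrite ≡ᵇ-true⁻ v x v≡ᵇx = ⊥-elim (false≢true ev (proj₂ (h x (here refl))))

  countAccepting-first : ∀ m d t r c → Demand d r c → c + length r ≡ suc m → CountHyp m → ∀ v → v ∈ consec n 1 →
    countB (λ τ → covers n (without d v) τ ∧ accepts t r (v ∷ τ)) (allLists n m)
      ≡ (if (d v ∧ not (extreme v)) then middleTerm c (length r) t else 0) + (if isHead r v then extremeTerm c r t else 0)
  countAccepting-first m d t r c I e IH v vin with extreme v in ev
  ... | true rewrite ∧-zeroʳ (d v) = countAccepting-extreme-first m d t r c I e IH v ev
  ... | false = trans (countAccepting-middle-first m d t r c I e IH v vin ev) (sym (trans
                  (cong₂ (λ a b → (if a then middleTerm c (length r) t else 0) + (if b then extremeTerm c r t else 0))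
                         (∧-identityʳ (d v)) (isHead-middle (Demand.pending-extreme I) ev))
                  (+-identityʳ _)))

  headCount : List ℕ → ℕ
  headCount [] = 0
  headCount (_ ∷ _) = 1

  countB-isHead : ∀ r → (∀ v → v ∈ r → v ∈ consec n 1 × extreme v ≡ true) → countB (isHead r) (consec n 1) ≡ headCount r
  countB-isHead [] h = countB-false (consec n 1)
  countB-isHead (x ∷ r') h = countB-≡ᵇ-member (distinct-consec n 1) (proj₁ (h x (here refl)))

  countAccepting≡acceptCount : ∀ m d t r c → Demand d r c → c + length r ≡ m → countAccepting m d t r ≡ acceptCount c (length r) t
  countAccepting≡acceptCount zero d t [] zero I e = cong (λ b → if b ∧ true then 1 else 0) cv
    where
    cv : covers n d [] ≡ true
    cv = all-intro _ (consec n 1) (λ v p → cong (λ b → not b ∨ false) (countB-none⁻ d (consec n 1) (demand-total I) v p))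
  countAccepting≡acceptCount (suc m) d t r c I e = begin
      countAccepting (suc m) d t r
    ≡⟨ countB-allLists-suc n m _ ⟩
      sumMap (λ v → countB (λ τ → covers n d (v ∷ τ) ∧ accepts t r (v ∷ τ)) (allLists n m)) (consec n 1)
    ≡⟨ sumMap-cong _ _ (consec n 1) (λ v vin → trans (countB-ext _ _ (allLists n m) (λ τ → cong (_∧ accepts t r (v ∷ τ)) (covers-∷ n d v τ))) (countAccepting-first m d t r c I e (countAccepting≡acceptCount m) v vin)) ⟩
      sumMap (λ v → (if middle-demanded v then middleTerm c (length r) t else 0) + (if isHead r v then extremeTerm c r t else 0)) (consec n 1)
    ≡⟨ sumMap-+ _ _ (consec n 1) ⟩
      sumMap (λ v → if middle-demanded v then middleTerm c (length r) t else 0) (consec n 1) + sumMap (λ v → if isHead r v then extremeTerm c r t else 0) (consec n 1)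
    ≡⟨ cong₂ _+_ (sumMap-indicator middle-demanded _ (consec n 1)) (sumMap-indicator (isHead r) _ (consec n 1)) ⟩
      countB middle-demanded (consec n 1) * middleTerm c (length r) t + countB (isHead r) (consec n 1) * extremeTerm c r t
    ≡⟨ cong₂ (λ a b → a * middleTerm c (length r) t + b * extremeTerm c r t) (Demand.demand-middle I) head-count ⟩
      c * middleTerm c (length r) t + headCount r * extremeTerm c r t
    ≡⟨ combine c r e ⟩
      acceptCount c (length r) t
    ∎
    where
    open ≡-Reasoning
    middle-demanded = λ w → d w ∧ not (extreme w)
    head-count : countB (isHead r) (consec n 1) ≡ headCount r
    head-count = countB-isHead r (Demand.pending-extreme I)
    combine : ∀ c r → c + length r ≡ suc m → c * middleTerm c (length r) t + headCount r * extremeTerm c r t ≡ acceptCount c (length r) t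
    combine zero (x ∷ r') _ = +-identityʳ _
    combine (suc c') [] _ with t ≡ᵇ j
    ... | true = trans (+-identityʳ _) (*-zeroʳ (suc c'))
    ... | false = +-identityʳ _
    combine (suc c') (x ∷ r') _ = cong₂ _+_ (*-if0 (suc c') (t ≡ᵇ j) _) (+-identityʳ _)

  ≡ᵇ-false-past : ∀ {t} → j < t → (t ≡ᵇ j) ≡ false
  ≡ᵇ-false-past {t} p = ≡ᵇ-false t j (λ e → <-irrefl (sym e) p)

  -- (c + s)! / s! counts the placements of c distinct middle values into s + 1 allowed gaps: past j,
  -- s remaining extreme values leave s + 1 gaps; before j, s + 1 values leave s + 2, one forbidden.
  acceptCount-past : ∀ c s t → j < t → acceptCount c s t * s ! ≡ (c + s) !
  acceptCount-past zero zero t p = refl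
  acceptCount-past (suc c) zero t p = begin
      (if t ≡ᵇ j then 0 else suc c * acceptCount c zero t) * 1
    ≡⟨ cong (_* 1) (if-false-0 _ (≡ᵇ-false-past p)) ⟩
      (suc c * acceptCount c zero t) * 1
    ≡⟨ *-assoc (suc c) (acceptCount c zero t) 1 ⟩
      suc c * (acceptCount c zero t * 1)
    ≡⟨ cong₂ _*_ (cong suc (sym (+-identityʳ c))) (acceptCount-past c zero t p) ⟩
      suc (c + 0) * (c + 0) !
    ∎
    where open ≡-Reasoning
  acceptCount-past zero (suc s) t p = trans (*-exchangeˡ (acceptCount zero s (suc t)) (suc s) (s !)) (cong (suc s *_) (acceptCount-past zero s (suc t) (m<n⇒m<1+n p)))
  acceptCount-past (suc c) (suc s) t p = begin
      ((if t ≡ᵇ j then 0 else suc c * acceptCount c (suc s) t) + acceptCount (suc c) s (suc t)) * (suc s * s !)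
    ≡⟨ cong (λ z → (z + acceptCount (suc c) s (suc t)) * (suc s * s !)) (if-false-0 _ (≡ᵇ-false-past p)) ⟩
      (suc c * acceptCount c (suc s) t + acceptCount (suc c) s (suc t)) * (suc s * s !)
    ≡⟨ *-+-exchange (suc c) (acceptCount c (suc s) t) (acceptCount (suc c) s (suc t)) (suc s) (s !) ⟩
      suc c * (acceptCount c (suc s) t * (suc s * s !)) + suc s * (acceptCount (suc c) s (suc t) * s !)
    ≡⟨ cong₂ (λ a b → suc c * a + suc s * b) (acceptCount-past c (suc s) t p) (trans (acceptCount-past (suc c) s (suc t) (m<n⇒m<1+n p)) (cong _! (sym (+-suc c s)))) ⟩
      suc c * (c + suc s) ! + suc s * (c + suc s) !
    ≡⟨ sym (*-distribʳ-+ ((c + suc s) !) (suc c) (suc s)) ⟩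
      (suc c + suc s) * (c + suc s) !
    ∎
    where open ≡-Reasoning

  acceptCount-closed : ∀ c s t → t ≤ j → j ≤ t + suc s → acceptCount c (suc s) t * s ! ≡ (c + s) !
  acceptCount-closed zero s t p q with m≤n⇒m<n∨m≡n p
  ... | inj₂ refl = acceptCount-past zero s (suc t) ≤-refl
  acceptCount-closed zero zero t p q | inj₁ lt = refl
  acceptCount-closed zero (suc s) t p q | inj₁ lt =
    trans (*-exchangeˡ (acceptCount zero (suc s) (suc t)) (suc s) (s !))
          (cong (suc s *_) (acceptCount-closed zero s (suc t) lt (≤-trans q (≤-reflexive (+-suc t (suc s))))))
  acceptCount-closed (suc c) s t p q with m≤n⇒m<n∨m≡n p
  ... | inj₂ refl = trans (cong (λ z → (z + acceptCount (suc c) s (suc t)) * s !) (if-true-0 _ (≡ᵇ-true t t refl))) (acceptCount-past (suc c) s (suc t) ≤-refl)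
  acceptCount-closed (suc c) zero t p q | inj₁ lt = begin
      ((if t ≡ᵇ j then 0 else suc c * acceptCount c 1 t) + acceptCount (suc c) zero (suc t)) * 1
    ≡⟨ cong₂ (λ a b → (a + b) * 1) (if-false-0 _ (≡ᵇ-false t j (λ e → <-irrefl e lt))) (if-true-0 _ (≡ᵇ-true (suc t) j (≤-antisym lt (≤-trans q (≤-reflexive (+-comm t 1)))))) ⟩
      (suc c * acceptCount c 1 t + 0) * 1
    ≡⟨ trans (cong (_* 1) (+-identityʳ (suc c * acceptCount c 1 t))) (*-assoc (suc c) (acceptCount c 1 t) 1) ⟩
      suc c * (acceptCount c 1 t * 1)
    ≡⟨ cong₂ _*_ (cong suc (sym (+-identityʳ c))) (acceptCount-closed c zero t p q) ⟩
      suc (c + 0) * (c + 0) !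
    ∎
    where open ≡-Reasoning
  acceptCount-closed (suc c) (suc s) t p q | inj₁ lt = begin
      ((if t ≡ᵇ j then 0 else suc c * acceptCount c (suc (suc s)) t) + acceptCount (suc c) (suc s) (suc t)) * (suc s * s !)
    ≡⟨ cong (λ z → (z + acceptCount (suc c) (suc s) (suc t)) * (suc s * s !)) (if-false-0 _ (≡ᵇ-false t j (λ e → <-irrefl e lt))) ⟩
      (suc c * acceptCount c (suc (suc s)) t + acceptCount (suc c) (suc s) (suc t)) * (suc s * s !)
    ≡⟨ *-+-exchange (suc c) (acceptCount c (suc (suc s)) t) (acceptCount (suc c) (suc s) (suc t)) (suc s) (s !) ⟩
      suc c * (acceptCount c (suc (suc s)) t * (suc s * s !)) + suc s * (acceptCount (suc c) (suc s) (suc t) * s !)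
    ≡⟨ cong₂ (λ a b → suc c * a + suc s * b) (acceptCount-closed c (suc s) t p q)
         (trans (acceptCount-closed (suc c) s (suc t) lt (≤-trans q (≤-reflexive (+-suc t (suc s))))) (cong _! (sym (+-suc c s)))) ⟩
      suc c * (c + suc s) ! + suc s * (c + suc s) !
    ≡⟨ sym (*-distribʳ-+ ((c + suc s) !) (suc c) (suc s)) ⟩
      (suc c + suc s) * (c + suc s) !
    ∎
    where open ≡-Reasoning

  meshP : MeshPattern
  meshP = mesh k π (R-thm i j)

  orderIsoAt : List ℕ → ℕ → ℕ → Bool
  orderIsoAt values a b = not ((at values a <ᵇ at values b) ∧ not (at π a <ᵇ at π b)) ∧ not ((at π a <ᵇ at π b) ∧ not (at values a <ᵇ at values b))

  orderIso : List ℕ → Bool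
  orderIso values = all (λ a → all (λ b → orderIsoAt values a b) (consec k 1)) (consec k 1)

  -- positionBound is and valueBound vals are the i_x and v_y of an occurrence, sentinels included.
  positionBound : List ℕ → ℕ → ℕ
  positionBound is x = at (0 ∷ is ++ (suc n ∷ [])) (suc x)

  sortedValues : List ℕ → List ℕ
  sortedValues values = filterB (λ w → elem w values) (consec n 1)

  valueBound : List ℕ → ℕ → ℕ
  valueBound values y = at (0 ∷ sortedValues values ++ (suc n ∷ [])) (suc y)

  avoidsAt : List ℕ → List ℕ → ℕ → ℕ → ℕ → Bool
  avoidsAt τ is x y m = not ((positionBound is x <ᵇ m) ∧ (m <ᵇ positionBound is (suc x)) ∧ (valueBound (map (at τ) is) y <ᵇ at τ m) ∧ (at τ m <ᵇ valueBound (map (at τ) is) (suc y)))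

  boxEmpty : List ℕ → List ℕ → ℕ → ℕ → Bool
  boxEmpty τ is x y = all (avoidsAt τ is x y) (consec n 1)

  boxesEmpty : List ℕ → List ℕ → Bool
  boxesEmpty τ is = all (λ x → all (λ y → not (R-thm i j x y) ∨ boxEmpty τ is x y) (consec (suc k) 0)) (consec (suc k) 0)

  -- `occurrence` with its ranges abstracted, so that they can be rewritten into `consec` form.
  occurrenceForm : List ℕ → List ℕ → List ℕ → List ℕ → List ℕ → List ℕ → Bool
  occurrenceForm τ is R1k R0k R1n S =
    all (λ a → all (λ b → orderIsoAt (map (at τ) is) a b) R1k) R1k ∧
    all (λ x → all (λ y → not (R-thm i j x y) ∨
      all (λ m → not ((positionBound is x <ᵇ m) ∧ (m <ᵇ positionBound is (suc x))
         ∧ (at (0 ∷ S ++ (suc n ∷ [])) (suc y) <ᵇ at τ m) ∧ (at τ m <ᵇ at (0 ∷ S ++ (suc n ∷ [])) (suc (suc y))))) R1n) R0k) R0k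

  occurrence≡ : ∀ τ is → occurrence n τ meshP is ≡ (orderIso (map (at τ) is) ∧ boxesEmpty τ is)
  occurrence≡ τ is = trans step1 (cong₂ (λ A B → occurrenceForm τ is (consec k 1) (consec (suc k) 0) A B) (range≡consec 1 n)
                  (trans (filter≡filterB (λ w → elem w (map (at τ) is)) (range 1 n)) (cong (filterB (λ w → elem w (map (at τ) is))) (range≡consec 1 n))))
    where
    step1 : occurrence n τ meshP is ≡ occurrenceForm τ is (consec k 1) (consec (suc k) 0) (range 1 n) (filter (λ w → T? (elem w (map (at τ) is))) (range 1 n))
    step1 = cong₂ (λ A B → occurrenceForm τ is A B (range 1 n) (filter (λ w → T? (elem w (map (at τ) is))) (range 1 n))) (range≡consec 1 k) (range≡consec 0 k)

  isOccurrence : List ℕ → List ℕ → Bool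
  isOccurrence τ is = orderIso (map (at τ) is) ∧ boxesEmpty τ is

  contains≡ : ∀ τ → contains n meshP τ ≡ any (isOccurrence τ) (choose (consec n 1) k)
  contains≡ τ = trans (cong (λ L → any (occurrence n τ meshP) (choose L k)) (range≡consec 1 n)) (any-cong _ _ (choose (consec n 1) k) (occurrence≡ τ))

  atFrom : ℕ → List ℕ → ℕ → ℕ
  atFrom a τ m = at τ (suc (m ∸ a))

  extremePositions : ℕ → List ℕ → List ℕ
  extremePositions a [] = []
  extremePositions a (v ∷ τ) = if extreme v then a ∷ extremePositions (suc a) τ else extremePositions (suc a) τ

  extremePositions-extreme : ∀ a v τ → extreme v ≡ true → extremePositions a (v ∷ τ) ≡ a ∷ extremePositions (suc a) τ
  extremePositions-extreme a v τ e rewrite e = refl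
  extremePositions-middle : ∀ a v τ → extreme v ≡ false → extremePositions a (v ∷ τ) ≡ extremePositions (suc a) τ
  extremePositions-middle a v τ e rewrite e = refl
  filterB-extreme : ∀ v τ → extreme v ≡ true → filterB extreme (v ∷ τ) ≡ v ∷ filterB extreme τ
  filterB-extreme v τ e rewrite e = refl
  filterB-middle : ∀ v τ → extreme v ≡ false → filterB extreme (v ∷ τ) ≡ filterB extreme τ
  filterB-middle v τ e rewrite e = refl

  atFrom-∷ : ∀ {a m} v τ → a < m → atFrom a (v ∷ τ) m ≡ atFrom (suc a) τ m
  atFrom-∷ {a} {m} v τ p rewrite ∸-suc p = refl

  atFrom-head : ∀ a v τ → atFrom a (v ∷ τ) a ≡ v
  atFrom-head a v τ rewrite n∸n≡0 a = refl

  extremePositions-range : ∀ a τ {m} → m ∈ extremePositions a τ → a ≤ m × m < a + length τ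
  extremePositions-range a [] ()
  extremePositions-range a (v ∷ τ) {m} p with true-or-false (extreme v)
  ... | inj₁ e with subst (m ∈_) (extremePositions-extreme a v τ e) p
  ... | here refl = ≤-refl , m<m+n a (s≤s z≤n)
  ... | there q with extremePositions-range (suc a) τ q
  ... | x , y = <⇒≤ x , subst (m <_) (sym (+-suc a (length τ))) y
  extremePositions-range a (v ∷ τ) {m} p | inj₂ e with extremePositions-range (suc a) τ (subst (m ∈_) (extremePositions-middle a v τ e) p)
  ... | x , y = <⇒≤ x , subst (m <_) (sym (+-suc a (length τ))) y

  map-atFrom-extremePositions : ∀ a τ → map (atFrom a τ) (extremePositions a τ) ≡ filterB extreme τ
  map-atFrom-extremePositions a [] = refl
  map-atFrom-extremePositions a (v ∷ τ) with true-or-false (extreme v)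
  ... | inj₁ e rewrite extremePositions-extreme a v τ e | filterB-extreme v τ e =
    cong₂ _∷_ (atFrom-head a v τ) (trans (map-cong-local (tabulate λ p → atFrom-∷ v τ (proj₁ (extremePositions-range (suc a) τ p)))) (map-atFrom-extremePositions (suc a) τ))
  ... | inj₂ e rewrite extremePositions-middle a v τ e | filterB-middle v τ e =
    trans (map-cong-local (tabulate λ p → atFrom-∷ v τ (proj₁ (extremePositions-range (suc a) τ p)))) (map-atFrom-extremePositions (suc a) τ)

  extremePositions∈choose : ∀ a τ → extremePositions a τ ∈ choose (consec (length τ) a) (length (filterB extreme τ))
  extremePositions∈choose a [] = here refl
  extremePositions∈choose a (v ∷ τ) with true-or-false (extreme v)
  ... | inj₁ e rewrite extremePositions-extreme a v τ e | filterB-extreme v τ e =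
    ∈-++⁺ˡ (∈-map⁺ (a ∷_) (extremePositions∈choose (suc a) τ))
  ... | inj₂ e rewrite extremePositions-middle a v τ e | filterB-middle v τ e = aux (length (filterB extreme τ)) (extremePositions∈choose (suc a) τ)
    where
    aux : ∀ K → extremePositions (suc a) τ ∈ choose (consec (length τ) (suc a)) K → extremePositions (suc a) τ ∈ choose (a ∷ consec (length τ) (suc a)) K
    aux zero q = q
    aux (suc K) q = ∈-++⁺ʳ _ q

  extremePositions≡filterB : ∀ a τ → extremePositions a τ ≡ filterB (λ m → extreme (atFrom a τ m)) (consec (length τ) a)
  extremePositions≡filterB a [] = refl
  extremePositions≡filterB a (v ∷ τ) with true-or-false (extreme v)
  ... | inj₁ e rewrite extremePositions-extreme a v τ e | atFrom-head a v τ | e =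
    cong (a ∷_) (trans (extremePositions≡filterB (suc a) τ) (filterB-cong _ _ (consec (length τ) (suc a)) (λ m p → cong extreme (sym (atFrom-∷ v τ (proj₁ (∈-consec⁻ (length τ) (suc a) p)))))))
  ... | inj₂ e rewrite extremePositions-middle a v τ e | atFrom-head a v τ | e =
    trans (extremePositions≡filterB (suc a) τ) (filterB-cong _ _ (consec (length τ) (suc a)) (λ m p → cong extreme (sym (atFrom-∷ v τ (proj₁ (∈-consec⁻ (length τ) (suc a) p))))))

  accepts⇒extremes : ∀ τ t r → accepts t r τ ≡ true → filterB extreme τ ≡ r
  accepts⇒extremes [] t [] _ = refl
  accepts⇒extremes [] t (x ∷ r) ()
  accepts⇒extremes (v ∷ τ) t r g with true-or-false (extreme v)
  accepts⇒extremes (v ∷ τ) t [] g | inj₁ e = ⊥-elim (false≢true (accepts-extreme-[] t v τ e) g)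
  accepts⇒extremes (v ∷ τ) t (x ∷ r) g | inj₁ e rewrite filterB-extreme v τ e with trans (sym (accepts-extreme-∷ t x r v τ e)) g
  ... | g' = cong₂ _∷_ (≡ᵇ-true⁻ v x (∧-elimˡ g')) (accepts⇒extremes τ (suc t) r (∧-elimʳ {v ≡ᵇ x} g'))
  accepts⇒extremes (v ∷ τ) t r g | inj₂ e rewrite filterB-middle v τ e = accepts⇒extremes τ t r (∧-elimʳ {not (t ≡ᵇ j)} (trans (sym (accepts-middle t r v τ e)) g))

  accepts-past-j : ∀ τ t r → j < t → filterB extreme τ ≡ r → accepts t r τ ≡ true
  accepts-past-j [] t [] _ _ = refl
  accepts-past-j (v ∷ τ) t r p f with true-or-false (extreme v)
  accepts-past-j (v ∷ τ) t r p f | inj₁ e rewrite filterB-extreme v τ e with r | f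
  ... | .(v ∷ filterB extreme τ) | refl = trans (accepts-extreme-∷ t v (filterB extreme τ) v τ e) (∧-intro (≡ᵇ-true v v refl) (accepts-past-j τ (suc t) _ (m<n⇒m<1+n p) refl))
  accepts-past-j (v ∷ τ) t r p f | inj₂ e rewrite filterB-middle v τ e =
    trans (accepts-middle t r v τ e) (∧-intro (cong not (≡ᵇ-false t j (λ q → <-irrefl (sym q) p))) (accepts-past-j τ t r p f))

  at-lowerBound : ∀ xs b → (∀ y → y ∈ xs → b ≤ y) → ∀ w → b ≤ at xs (suc w) ⊎ at xs (suc (suc w)) ≡ 0
  at-lowerBound [] b h w = inj₂ refl
  at-lowerBound (y ∷ ys) b h zero = inj₁ (h y (here refl))
  at-lowerBound (y ∷ ys) b h (suc w) = at-lowerBound ys b (λ z p → h z (there p)) w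

  extremePositions-lowerBound : ∀ a τ E → a + length τ ≤ E → ∀ y → y ∈ extremePositions a τ ++ (E ∷ []) → a ≤ y
  extremePositions-lowerBound a τ E le y p with ∈-++⁻ (extremePositions a τ) p
  ... | inj₁ q = proj₁ (extremePositions-range a τ q)
  ... | inj₂ (here refl) = ≤-trans (m≤m+n a (length τ)) le

  -- The positions of the extreme values of τ (read from position a on), between the sentinels L and E;
  -- after t extreme values have been read, the shaded box (j , i) is the gap after entry j ∸ t.
  boundaries : ℕ → ℕ → List ℕ → ℕ → List ℕ
  boundaries L a τ E = L ∷ extremePositions a τ ++ (E ∷ [])

  MiddleFreeGap : ℕ → ℕ → ℕ → List ℕ → ℕ → Set
  MiddleFreeGap t L a τ E = ∀ m → a ≤ m → m < a + length τ → extreme (atFrom a τ m) ≡ false →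
    at (boundaries L a τ E) (suc (j ∸ t)) < m → m < at (boundaries L a τ E) (suc (suc (j ∸ t))) → ⊥

  accepts⇒gap-clear : ∀ τ a t r L E → accepts t r τ ≡ true → t ≤ j → a + length τ ≤ E → MiddleFreeGap t L a τ E
  accepts⇒gap-clear [] a t r L E g tj aE m am ma = ⊥-elim (<-irrefl refl (≤-trans ma (≤-trans (≤-reflexive (+-identityʳ a)) am)))
  accepts⇒gap-clear (v ∷ τ) a t r L E g tj aE m am ma em lo hi with true-or-false (extreme v)
  ... | inj₁ e with m≤n⇒m<n∨m≡n am
  ... | inj₂ refl = false≢true em (trans (cong extreme (atFrom-head m v τ)) e)
  ... | inj₁ a<m with r
  ... | [] = false≢true (accepts-extreme-[] t v τ e) g
  ... | x ∷ r' with trans (sym (accepts-extreme-∷ t x r' v τ e)) g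
  ... | g' with m≤n⇒m<n∨m≡n tj
  ... | inj₂ refl rewrite n∸n≡0 t | extremePositions-extreme a v τ e = <-asym a<m hi
  ... | inj₁ t<j rewrite ∸-suc t<j | extremePositions-extreme a v τ e =
    accepts⇒gap-clear τ (suc a) (suc t) r' a E (∧-elimʳ {v ≡ᵇ x} g') t<j (≤-trans (≤-reflexive (sym (+-suc a (length τ)))) aE)
      m a<m (subst (m <_) (+-suc a (length τ)) ma) (trans (cong extreme (sym (atFrom-∷ v τ a<m))) em) lo hi
  accepts⇒gap-clear (v ∷ τ) a t r L E g tj aE m am ma em lo hi | inj₂ e with trans (sym (accepts-middle t r v τ e)) g
  ... | g' with m≤n⇒m<n∨m≡n tj
  ... | inj₂ refl = false≢true (cong not (≡ᵇ-true t t refl)) (∧-elimˡ g')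
  ... | inj₁ t<j rewrite ∸-suc t<j | extremePositions-middle a v τ e with m≤n⇒m<n∨m≡n am
  ... | inj₂ refl with at-lowerBound (extremePositions (suc m) τ ++ (E ∷ [])) (suc m) (extremePositions-lowerBound (suc m) τ E (≤-trans (≤-reflexive (sym (+-suc m (length τ)))) aE)) (j ∸ suc t)
  ... | inj₁ q = <-asym lo (<-≤-trans (n<1+n m) q)
  ... | inj₂ q = ⊥-elim (n≮0 (<-≤-trans hi (≤-reflexive q)))
  accepts⇒gap-clear (v ∷ τ) a t r L E g tj aE m am ma em lo hi | inj₂ e | g' | inj₁ t<j | inj₁ a<m =
    accepts⇒gap-clear τ (suc a) t r L E (∧-elimʳ {not (t ≡ᵇ j)} g') tj (≤-trans (≤-reflexive (sym (+-suc a (length τ)))) aE)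
      m a<m (subst (m <_) (+-suc a (length τ)) ma) (trans (cong extreme (sym (atFrom-∷ v τ a<m))) em)
      (subst (λ z → at (L ∷ extremePositions (suc a) τ ++ (E ∷ [])) (suc z) < m) (sym (∸-suc t<j)) lo)
      (subst (λ z → m < at (L ∷ extremePositions (suc a) τ ++ (E ∷ [])) (suc (suc z))) (sym (∸-suc t<j)) hi)

  at-head-lowerBound : ∀ xs b E → (∀ y → y ∈ xs → b ≤ y) → b ≤ E → b ≤ at (xs ++ E ∷ []) 1
  at-head-lowerBound [] b E h p = p
  at-head-lowerBound (y ∷ ys) b E h p = h y (here refl)

  gap-clear⇒accepts : ∀ τ a t r L E → filterB extreme τ ≡ r → L < a → a + length τ ≤ E → t ≤ j →
    MiddleFreeGap t L a τ E → accepts t r τ ≡ true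
  gap-clear⇒accepts [] a t .[] L E refl La aE tj H = refl
  gap-clear⇒accepts (v ∷ τ) a t r L E f La aE tj H with true-or-false (extreme v)
  gap-clear⇒accepts (v ∷ τ) a t r L E f La aE tj H | inj₁ e rewrite filterB-extreme v τ e with r | f
  ... | .(v ∷ filterB extreme τ) | refl with m≤n⇒m<n∨m≡n tj
  ... | inj₂ refl = trans (accepts-extreme-∷ t v (filterB extreme τ) v τ e) (∧-intro (≡ᵇ-true v v refl) (accepts-past-j τ (suc t) _ ≤-refl refl))
  ... | inj₁ t<j = trans (accepts-extreme-∷ t v (filterB extreme τ) v τ e) (∧-intro (≡ᵇ-true v v refl)
        (gap-clear⇒accepts τ (suc a) (suc t) (filterB extreme τ) a E refl ≤-refl (≤-trans (≤-reflexive (sym (+-suc a (length τ)))) aE) t<j gap-rest))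
    where
    gap-rest : MiddleFreeGap (suc t) a (suc a) τ E
    gap-rest m am ma em lo hi = H m (<⇒≤ am) (subst (m <_) (sym (+-suc a (length τ))) ma) (trans (cong extreme (atFrom-∷ v τ am)) em) lo' hi'
      where
      lo' : at (L ∷ extremePositions a (v ∷ τ) ++ (E ∷ [])) (suc (j ∸ t)) < m
      lo' rewrite extremePositions-extreme a v τ e | ∸-suc t<j = lo
      hi' : m < at (L ∷ extremePositions a (v ∷ τ) ++ (E ∷ [])) (suc (suc (j ∸ t)))
      hi' rewrite extremePositions-extreme a v τ e | ∸-suc t<j = hi
  gap-clear⇒accepts (v ∷ τ) a t r L E f La aE tj H | inj₂ e rewrite filterB-middle v τ e with m≤n⇒m<n∨m≡n tj
  ... | inj₂ refl = ⊥-elim (H a ≤-refl (m<m+n a (s≤s z≤n)) (trans (cong extreme (atFrom-head a v τ)) e) lo hi)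
    where
    lo : at (L ∷ extremePositions a (v ∷ τ) ++ (E ∷ [])) (suc (t ∸ t)) < a
    lo rewrite n∸n≡0 t = La
    hi : a < at (L ∷ extremePositions a (v ∷ τ) ++ (E ∷ [])) (suc (suc (t ∸ t)))
    hi rewrite n∸n≡0 t | extremePositions-middle a v τ e = at-head-lowerBound (extremePositions (suc a) τ) (suc a) E (λ y p → proj₁ (extremePositions-range (suc a) τ p)) (≤-trans (s≤s (m≤m+n a (length τ))) (≤-trans (≤-reflexive (sym (+-suc a (length τ)))) aE))
  ... | inj₁ t<j = trans (accepts-middle t r v τ e) (∧-intro (cong not (≡ᵇ-false t j (λ q → <-irrefl q t<j)))
        (gap-clear⇒accepts τ (suc a) t r L E f (m<n⇒m<1+n La) (≤-trans (≤-reflexive (sym (+-suc a (length τ)))) aE) tj gap-rest))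
    where
    gap-rest : MiddleFreeGap t L (suc a) τ E
    gap-rest m am ma em lo hi = H m (<⇒≤ am) (subst (m <_) (sym (+-suc a (length τ))) ma) (trans (cong extreme (atFrom-∷ v τ am)) em) lo' hi'
      where
      lo' : at (L ∷ extremePositions a (v ∷ τ) ++ (E ∷ [])) (suc (j ∸ t)) < m
      lo' rewrite extremePositions-middle a v τ e = lo
      hi' : m < at (L ∷ extremePositions a (v ∷ τ) ++ (E ∷ [])) (suc (suc (j ∸ t)))
      hi' rewrite extremePositions-middle a v τ e = hi

  module Assuming (k≥1 : 1 ≤ k) (πp : isPerm k π ≡ true) (i≤k : i ≤ k) (j≤k : j ≤ k) (k≤n : k ≤ n) where

    π-facts : PermutationFacts k π
    π-facts = isPerm⇒facts k π πp

    D+k≡n : D + k ≡ n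
    D+k≡n = m∸n+n≡m k≤n

    inflate-range : ∀ {x} → x ∈ consec k 1 → inflate x ∈ consec n 1
    inflate-range {x} p with ∈-consec1⁻ p | ≤-<-connex x i
    ... | a , b | inj₁ lo rewrite inflate-low lo = ∈-consec1⁺ a (≤-trans b k≤n)
    ... | a , b | inj₂ hi rewrite inflate-high hi = ∈-consec1⁺ (≤-trans a (m≤m+n x D)) (≤-trans (+-monoˡ-≤ D b) (≤-reflexive (trans (+-comm k D) D+k≡n)))

    inflate-onto : ∀ {v} → v ∈ consec n 1 → extreme v ≡ true → ∃[ x ] (x ∈ consec k 1 × inflate x ≡ v)
    inflate-onto {v} p e with ∈-consec1⁻ p | extreme⁻ e
    ... | a , b | inj₁ lo = v , ∈-consec1⁺ a (≤-trans lo i≤k) , inflate-low lo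
    ... | a , b | inj₂ hi = v ∸ D , ∈-consec1⁺ (≤-trans (s≤s z≤n) ix) xk , trans (inflate-high ix) (m∸n+n≡m D≤v)
      where
      D≤v : D ≤ v
      D≤v = ≤-trans (m≤m+n D i) (<⇒≤ hi)
      vD : D + (v ∸ D) ≡ v
      vD = m+[n∸m]≡n D≤v
      ix : i < v ∸ D
      ix = +-cancelˡ-< D i (v ∸ D) (subst (D + i <_) (sym vD) hi)
      xk : v ∸ D ≤ k
      xk = ≤-trans (∸-monoˡ-≤ D (≤-trans b (≤-reflexive (sym D+k≡n)))) (≤-reflexive (m+n∸m≡n D k))

    π↑-length : length π↑ ≡ k
    π↑-length = trans (length-map inflate π) (PermutationFacts.length≡ π-facts)

    π↑-distinct : Distinct π↑
    π↑-distinct = distinct-map inflate (λ _ _ _ _ → inflate-injective) (PermutationFacts.distinct π-facts)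

    π↑-extreme : ∀ v → v ∈ π↑ → v ∈ consec n 1 × extreme v ≡ true
    π↑-extreme v p with ∈-map⁻ inflate p
    ... | x , q , refl = inflate-range (PermutationFacts.⊆consec π-facts x q) , inflate-extreme x

    π↑-covers : ∀ v → v ∈ consec n 1 → extreme v ≡ true → v ∈ π↑
    π↑-covers v p e with inflate-onto p e
    ... | x , q , refl = ∈-map⁺ inflate (PermutationFacts.⊇consec π-facts x q)

    elem-π↑ : ∀ v → v ∈ consec n 1 → elem v π↑ ≡ extreme v
    elem-π↑ v p with true-or-false (extreme v)
    ... | inj₁ e rewrite e = ∈-elem π↑ (π↑-covers v p e)
    ... | inj₂ e rewrite e = elem-false π↑ (λ q → false≢true e (proj₂ (π↑-extreme v q)))

    countB-extreme : countB extreme (consec n 1) ≡ k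
    countB-extreme = trans (countB-cong _ _ (consec n 1) (λ v p → sym (trans (cong (extreme v ∧_) (elem-π↑ v p)) (∧-idem (extreme v)))))
                       (trans (countB-extreme-pending π↑-distinct π↑-extreme) π↑-length)

    initial-demand : Demand (λ _ → true) π↑ D
    initial-demand = record { demand-extreme = λ v p e → sym (trans (elem-π↑ v p) e) ; demand-middle = middle-count ; pending-distinct = π↑-distinct ; pending-extreme = π↑-extreme }
      where
      middle-count : countB (λ v → true ∧ not (extreme v)) (consec n 1) ≡ D
      middles = countB (λ v → true ∧ not (extreme v)) (consec n 1)
      n-split : n ≡ countB extreme (consec n 1) + middles
      n-split = trans (sym (length-consec n 1)) (trans (sym (countB-true (consec n 1))) (countB-split (λ _ → true) extreme (consec n 1)))
      middle-count = +-cancelʳ-≡ k middles D (trans (+-comm middles k) (trans (cong (_+ middles) (sym countB-extreme)) (trans (sym n-split) (sym D+k≡n))))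

    countAccepting-initial : countAccepting n (λ _ → true) 0 π↑ ≡ acceptCount D k 0
    countAccepting-initial = trans (countAccepting≡acceptCount n (λ _ → true) 0 π↑ D initial-demand (trans (cong (D +_) π↑-length) D+k≡n)) (cong (λ z → acceptCount D z 0) π↑-length)

    k-suc : k ≡ suc (k ∸ 1)
    k-suc = sym (trans (+-comm 1 (k ∸ 1)) (m∸n+n≡m k≥1))

    acceptCount-initial : acceptCount D k 0 * (k ∸ 1) ! ≡ (n ∸ 1) !
    acceptCount-initial = trans (cong (λ z → acceptCount D z 0 * (k ∸ 1) !) k-suc)
                  (trans (acceptCount-closed D (k ∸ 1) 0 z≤n (≤-trans j≤k (≤-reflexive k-suc))) (cong _! D+[k∸1]≡n∸1))
      where
      D+[k∸1]≡n∸1 : D + (k ∸ 1) ≡ n ∸ 1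
      D+[k∸1]≡n∸1 = sym (trans (cong (_∸ 1) (trans (sym D+k≡n) (cong (D +_) k-suc))) (cong (_∸ 1) (+-suc D (k ∸ 1))))

    extremes≡inflate-consec : filterB extreme (consec n 1) ≡ map inflate (consec k 1)
    extremes≡inflate-consec = begin
        filterB extreme (consec n 1)
      ≡⟨ cong (λ z → filterB extreme (consec z 1)) nsplit ⟩
        filterB extreme (consec (i + (D + (k ∸ i))) 1)
      ≡⟨ cong (filterB extreme) (trans (consec-+ i (D + (k ∸ i)) 1) (cong (consec i 1 ++_) (consec-+ D (k ∸ i) (suc i)))) ⟩
        filterB extreme (consec i 1 ++ (consec D (suc i) ++ consec (k ∸ i) (suc i + D)))
      ≡⟨ trans (filterB-++ extreme (consec i 1) _) (cong (filterB extreme (consec i 1) ++_) (filterB-++ extreme (consec D (suc i)) _)) ⟩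
        filterB extreme (consec i 1) ++ (filterB extreme (consec D (suc i)) ++ filterB extreme (consec (k ∸ i) (suc i + D)))
      ≡⟨ cong₂ (λ A B → A ++ B) (filterB-all extreme (consec i 1) lowE) (cong₂ _++_ (filterB-none extreme (consec D (suc i)) midE) (filterB-all extreme (consec (k ∸ i) (suc i + D)) hiE)) ⟩
        consec i 1 ++ consec (k ∸ i) (suc i + D)
      ≡⟨ sym (cong₂ _++_ (map-id-local (tabulate λ p → lowD _ p))
                        (trans (map-cong-local (tabulate λ p → hiD _ p)) (map-+-consec D (k ∸ i) (suc i)))) ⟩
        map inflate (consec i 1) ++ map inflate (consec (k ∸ i) (suc i))
      ≡⟨ sym (trans (cong (map inflate) (consec-+ i (k ∸ i) 1)) (map-++ inflate (consec i 1) _)) ⟩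
        map inflate (consec (i + (k ∸ i)) 1)
      ≡⟨ cong (λ z → map inflate (consec z 1)) (m+[n∸m]≡n i≤k) ⟩
        map inflate (consec k 1)
      ∎
      where
      open ≡-Reasoning
      nsplit : n ≡ i + (D + (k ∸ i))
      nsplit = trans (sym D+k≡n) (trans (cong (D +_) (sym (m+[n∸m]≡n i≤k))) (+-exchangeˡ D i (k ∸ i)))
      lowE : ∀ x → x ∈ consec i 1 → extreme x ≡ true
      lowE x p = extreme-low (≤-pred (subst (x <_) refl (proj₂ (∈-consec⁻ i 1 p))))
      midE : ∀ x → x ∈ consec D (suc i) → extreme x ≡ false
      midE x p with ∈-consec⁻ D (suc i) p
      ... | a , b = not-extreme a (≤-pred (subst (x <_) (cong suc (+-comm i D)) b))
      hiE : ∀ x → x ∈ consec (k ∸ i) (suc i + D) → extreme x ≡ true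
      hiE x p = extreme-high (subst (_≤ x) (cong suc (+-comm i D)) (proj₁ (∈-consec⁻ (k ∸ i) (suc i + D) p)))
      lowD : ∀ x → x ∈ consec i 1 → inflate x ≡ x
      lowD x p = inflate-low (≤-pred (proj₂ (∈-consec⁻ i 1 p)))
      hiD : ∀ x → x ∈ consec (k ∸ i) (suc i) → inflate x ≡ x + D
      hiD x p = inflate-high (proj₁ (∈-consec⁻ (k ∸ i) (suc i) p))

    length-++-snoc : (xs : List ℕ) → length (xs ++ suc n ∷ []) ≡ suc (length xs)
    length-++-snoc xs = trans (length-++ xs) (+-comm (length xs) 1)

    inflate-suc-k : inflate (suc k) ≡ suc n
    inflate-suc-k = trans (inflate-high (s≤s i≤k)) (cong suc (trans (+-comm k D) D+k≡n))

    bounds≡inflate : ∀ S → S ≡ map inflate (consec k 1) → ∀ y → y ≤ suc k → at (0 ∷ S ++ (suc n ∷ [])) (suc y) ≡ inflate y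
    bounds≡inflate S eS zero _ = sym (inflate-low z≤n)
    bounds≡inflate S eS (suc y) p with m≤n⇒m<n∨m≡n p
    ... | inj₁ (s≤s lt) = trans (at-++ˡ S _ y (subst (y <_) (sym lenS) lt))
                           (trans (cong (λ z → at z (suc y)) eS) (trans (at-map inflate (consec k 1) y (subst (y <_) (sym (length-consec k 1)) lt)) (cong inflate (at-consec k 1 y lt))))
      where lenS : length S ≡ k
            lenS = trans (cong length eS) (trans (length-map inflate (consec k 1)) (length-consec k 1))
    ... | inj₂ refl = trans (subst (λ z → at (S ++ (suc n ∷ [])) (suc z) ≡ suc n) lenS (at-++-length S [] (suc n))) (sym inflate-suc-k)
      where lenS : length S ≡ k
            lenS = trans (cong length eS) (trans (length-map inflate (consec k 1)) (length-consec k 1))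

    at-π↑ : ∀ a → a ∈ consec k 1 → at π↑ a ≡ inflate (at π a)
    at-π↑ a p with ∈-consec1⁻ p
    ... | s≤s z≤n , b = at-map inflate π _ (subst (_ <_) (sym (PermutationFacts.length≡ π-facts)) b)

    orderIso-π↑ : orderIso π↑ ≡ true
    orderIso-π↑ = all-intro _ (consec k 1) (λ a pa → all-intro _ (consec k 1) (λ b pb →
      subst (λ z → z ≡ true) (sym (cong₂ (λ u w → not ((u <ᵇ w) ∧ not (at π a <ᵇ at π b)) ∧ not ((at π a <ᵇ at π b) ∧ not (u <ᵇ w))) (at-π↑ a pa) (at-π↑ b pb)))
        (subst (λ z → (not (z ∧ not (at π a <ᵇ at π b)) ∧ not ((at π a <ᵇ at π b) ∧ not z)) ≡ true) (sym (inflate-<ᵇ (at π a) (at π b))) (⇔ᵇ-refl (at π a <ᵇ at π b)))))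

    module ForPermutation (τ : List ℕ) (τF : PermutationFacts n τ) where

      atFrom-1 : ∀ m → 1 ≤ m → atFrom 1 τ m ≡ at τ m
      atFrom-1 (suc m) _ = refl

      positions : List ℕ
      positions = extremePositions 1 τ

      positions≡filterB : positions ≡ filterB (λ m → extreme (at τ m)) (consec n 1)
      positions≡filterB = trans (extremePositions≡filterB 1 τ) (trans (cong (λ z → filterB (λ m → extreme (atFrom 1 τ m)) (consec z 1)) (PermutationFacts.length≡ τF))
                  (filterB-cong _ _ (consec n 1) (λ m p → cong extreme (atFrom-1 m (proj₁ (∈-consec1⁻ p))))))

      values-at-positions : map (at τ) positions ≡ filterB extreme τ
      values-at-positions = trans (map-cong-local (tabulate λ p → sym (atFrom-1 _ (proj₁ (extremePositions-range 1 τ p))))) (map-atFrom-extremePositions 1 τ)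

      τ-range : ∀ m → m ∈ consec n 1 → at τ m ∈ consec n 1
      τ-range m p with ∈-consec1⁻ p
      ... | s≤s {n = z} z≤n , b = PermutationFacts.⊆consec τF _ (at-∈ τ z (subst (z <_) (sym (PermutationFacts.length≡ τF)) b))

      τ-length : 1 + length τ ≤ suc n
      τ-length = s≤s (≤-reflexive (PermutationFacts.length≡ τF))

      module FromAccepts (g : accepts 0 π↑ τ ≡ true) where
        extremes≡π↑ : filterB extreme τ ≡ π↑
        extremes≡π↑ = accepts⇒extremes τ 0 π↑ g

        values≡π↑ : map (at τ) positions ≡ π↑
        values≡π↑ = trans values-at-positions extremes≡π↑

        sorted≡inflate : sortedValues (map (at τ) positions) ≡ map inflate (consec k 1)
        sorted≡inflate = trans (cong sortedValues values≡π↑) (trans (filterB-cong _ _ (consec n 1) (λ v p → elem-π↑ v p)) extremes≡inflate-consec)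

        valueBound≡inflate : ∀ y → y ≤ suc k → valueBound (map (at τ) positions) y ≡ inflate y
        valueBound≡inflate y p = bounds≡inflate (sortedValues (map (at τ) positions)) sorted≡inflate y p

        other-rows-empty : ∀ x y → y ≤ k → ¬ y ≡ i → boxEmpty τ positions x y ≡ true
        other-rows-empty x y yk ne = all-intro _ (consec n 1) (λ m _ → cong not (∧-falseʳ (positionBound positions x <ᵇ m) (∧-falseʳ (m <ᵇ positionBound positions (suc x)) (strictly-between-false m))))
          where
          strictly-between-false : ∀ m → ((valueBound (map (at τ) positions) y <ᵇ at τ m) ∧ (at τ m <ᵇ valueBound (map (at τ) positions) (suc y))) ≡ false
          strictly-between-false m rewrite valueBound≡inflate y (m≤n⇒m≤1+n yk) | valueBound≡inflate (suc y) (s≤s yk) | inflate-suc y ne = nothing-strictly-between (inflate y) (at τ m)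

        box-j-i-empty : boxEmpty τ positions j i ≡ true
        box-j-i-empty = all-intro _ (consec n 1) pt
          where
          V-i : valueBound (map (at τ) positions) i ≡ i
          V-i = trans (valueBound≡inflate i (m≤n⇒m≤1+n i≤k)) (inflate-low ≤-refl)
          V-suc-i : valueBound (map (at τ) positions) (suc i) ≡ suc (i + D)
          V-suc-i = trans (valueBound≡inflate (suc i) (s≤s i≤k)) (inflate-high ≤-refl)
          pt : ∀ m → m ∈ consec n 1 → avoidsAt τ positions j i m ≡ true
          pt m p rewrite V-i | V-suc-i with true-or-false (extreme (at τ m))
          ... | inj₁ e with extreme⁻ e
          ... | inj₁ lo = cong not (∧-falseʳ (positionBound positions j <ᵇ m) (∧-falseʳ (m <ᵇ positionBound positions (suc j)) (∧-falseˡ (at τ m <ᵇ suc (i + D)) (<ᵇ-false i (at τ m) lo))))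
          ... | inj₂ hi = cong not (∧-falseʳ (positionBound positions j <ᵇ m) (∧-falseʳ (m <ᵇ positionBound positions (suc j)) (∧-falseʳ (i <ᵇ at τ m) (<ᵇ-false (at τ m) (suc (i + D)) (subst (_< at τ m) (+-comm D i) hi)))))
          pt m p | inj₂ e with true-or-false (positionBound positions j <ᵇ m) | true-or-false (m <ᵇ positionBound positions (suc j))
          ... | inj₂ q | _ = cong not (∧-falseˡ ((m <ᵇ positionBound positions (suc j)) ∧ ((i <ᵇ at τ m) ∧ (at τ m <ᵇ suc (i + D)))) q)
          ... | inj₁ _ | inj₂ q = cong not (∧-falseʳ (positionBound positions j <ᵇ m) (∧-falseˡ ((i <ᵇ at τ m) ∧ (at τ m <ᵇ suc (i + D))) q))
          ... | inj₁ q1 | inj₁ q2 = ⊥-elim (accepts⇒gap-clear τ 1 0 π↑ 0 (suc n) g z≤n τ-length m (proj₁ (∈-consec1⁻ p))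
                  (subst (m <_) (cong suc (sym (PermutationFacts.length≡ τF))) (s≤s (proj₂ (∈-consec1⁻ p))))
                  (trans (cong extreme (atFrom-1 m (proj₁ (∈-consec1⁻ p)))) e) (<ᵇ-true⁻ _ _ q1) (<ᵇ-true⁻ _ _ q2))

        all-boxes-empty : boxesEmpty τ positions ≡ true
        all-boxes-empty = all-intro _ (consec (suc k) 0) (λ x px → all-intro _ (consec (suc k) 0) (λ y py → pt x y (≤-pred (proj₂ (∈-consec⁻ (suc k) 0 py)))))
          where
          pt : ∀ x y → y ≤ k → (not (R-thm i j x y) ∨ boxEmpty τ positions x y) ≡ true
          pt x y yk with y ≟ i
          ... | no ne = ∨-introʳ _ (other-rows-empty x y yk ne)
          ... | yes refl with x ≟ j
          ... | yes refl = ∨-introʳ _ box-j-i-empty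
          ... | no nx rewrite ≡ᵇ-true y y refl | ≡ᵇ-false x j nx = refl

        contains-meshP : contains n meshP τ ≡ true
        contains-meshP = trans (contains≡ τ) (any-intro (isOccurrence τ) (choose (consec n 1) k) inC
                   (∧-intro (trans (cong orderIso values≡π↑) orderIso-π↑) all-boxes-empty))
          where
          inC : positions ∈ choose (consec n 1) k
          inC = subst₂ (λ A B → positions ∈ choose (consec A 1) B) (PermutationFacts.length≡ τF) (trans (cong length extremes≡π↑) π↑-length) (extremePositions∈choose 1 τ)

      module FromOccurrence (is : List ℕ) (isin : is ∈ choose (consec n 1) k) (occ : isOccurrence τ is ≡ true) where
        iso-holds : orderIso (map (at τ) is) ≡ true
        iso-holds = ∧-elimˡ occ
        boxes-hold : boxesEmpty τ is ≡ true
        boxes-hold = ∧-elimʳ {orderIso (map (at τ) is)} occ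

        values : List ℕ
        values = map (at τ) is

        is-length : length is ≡ k
        is-length = choose-length (consec n 1) k is isin
        is⊆consec : ∀ m → m ∈ is → m ∈ consec n 1
        is⊆consec = choose-⊆ (consec n 1) k is isin
        is≡filterB : is ≡ filterB (λ m → elem m is) (consec n 1)
        is≡filterB = choose≡filterB (consec n 1) (distinct-consec n 1) k is isin
        is-distinct : Distinct is
        is-distinct = subst Distinct (sym is≡filterB) (distinct-filterB _ (distinct-consec n 1))
        is-increasing : Increasing is
        is-increasing = subst Increasing (sym is≡filterB) (increasing-filterB _ (increasing-consec n 1))

        values-length : length values ≡ k
        values-length = trans (length-map (at τ) is) is-length
        values⊆consec : ∀ u → u ∈ values → u ∈ consec n 1
        values⊆consec u p with ∈-map⁻ (at τ) p
        ... | m , q , refl = τ-range m (is⊆consec m q)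

        at-τ-injective : ∀ m1 m2 → m1 ∈ consec n 1 → m2 ∈ consec n 1 → at τ m1 ≡ at τ m2 → m1 ≡ m2
        at-τ-injective m1 m2 p1 p2 e with ∈-consec1⁻ p1 | ∈-consec1⁻ p2
        ... | s≤s {n = z1} z≤n , b1 | s≤s {n = z2} z≤n , b2 =
          cong suc (at-injective (PermutationFacts.distinct τF) z1 z2 (subst (z1 <_) (sym (PermutationFacts.length≡ τF)) b1) (subst (z2 <_) (sym (PermutationFacts.length≡ τF)) b2) e)

        values-distinct : Distinct values
        values-distinct = distinct-map (at τ) (λ a c pa pc → at-τ-injective a c (is⊆consec a pa) (is⊆consec c pc)) is-distinct

        sorted : List ℕ
        sorted = sortedValues values

        sorted-length : length sorted ≡ k
        sorted-length = trans (length-filterB _ (consec n 1)) (trans (sym (countB-restrict (λ _ → true) values-distinct (distinct-consec n 1) values⊆consec)) (trans (countB-true values) values-length))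

        sorted⊆consec : ∀ u → u ∈ sorted → u ∈ consec n 1
        sorted⊆consec u p = proj₁ (∈-filterB⁻ _ (consec n 1) p)

        valueBounds : List ℕ
        valueBounds = 0 ∷ sorted ++ (suc n ∷ [])

        V : ℕ → ℕ
        V y = at valueBounds (suc y)

        valueBounds-length : length valueBounds ≡ suc (suc k)
        valueBounds-length = cong suc (trans (length-++-snoc sorted) (cong suc sorted-length))

        valueBounds-increasing : Increasing valueBounds
        valueBounds-increasing = increasing-sentinels (increasing-filterB _ (increasing-consec n 1)) sorted⊆consec

        positionBounds-increasing : Increasing (0 ∷ is ++ (suc n ∷ []))
        positionBounds-increasing = increasing-sentinels is-increasing is⊆consec

        V≤suc-n : ∀ y → V y ≤ suc n
        V≤suc-n y = at-sentinels-≤ sorted⊆consec (suc y)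

        box-condition : ∀ x y → x ≤ k → y ≤ k → (not (R-thm i j x y) ∨ boxEmpty τ is x y) ≡ true
        box-condition x y xk yk = all-elim _ (consec (suc k) 0) (all-elim _ (consec (suc k) 0) boxes-hold (∈-consec⁺ (suc k) 0 z≤n (s≤s xk))) (∈-consec⁺ (suc k) 0 z≤n (s≤s yk))

        -- Every row other than i is shaded, so v_y and v_{y+1} are consecutive integers for y ≠ i.
        nothing-between-V : ∀ y → y ≤ k → ¬ y ≡ i → ∀ u → u ∈ consec n 1 → V y < u → u < V (suc y) → ⊥
        nothing-between-V y yk ne u uin lo hi with ∈-at τ (PermutationFacts.⊇consec τF u uin)
        ... | z , zl , eq with true-or-false (elem (suc z) is)
        ... | inj₁ mi = increasing-gap-empty valueBounds-increasing u∈bounds y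
                          (subst (suc y <_) (sym valueBounds-length) (s≤s (s≤s yk))) lo hi
          where
          u∈values : u ∈ values
          u∈values = subst (_∈ values) eq (∈-map⁺ (at τ) (elem-∈ is mi))
          u∈bounds : u ∈ valueBounds
          u∈bounds = there (∈-++⁺ˡ (∈-filterB⁺ _ (consec n 1) uin (∈-elem values u∈values)))
        ... | inj₂ mn = contra
          where
          m = suc z
          min : m ∈ consec n 1
          min = ∈-consec1⁺ (s≤s z≤n) (subst (z <_) (PermutationFacts.length≡ τF) zl)
          notin : ¬ m ∈ is ++ (suc n ∷ [])
          notin p with ∈-++⁻ is p
          ... | inj₁ q = false≢true mn (∈-elem is q)
          ... | inj₂ (here e) = <-irrefl e (s≤s (proj₂ (∈-consec1⁻ min)))
          contra : ⊥
          contra with bracket 0 (is ++ (suc n ∷ [])) positionBounds-increasing (s≤s z≤n) notin (∈-++⁺ʳ is (here refl)) (s≤s (proj₂ (∈-consec1⁻ min)))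
          ... | x , xl , lx , xh = false≢true (cong₂ (λ a b → not a ∨ b) Rt bigT) (box-condition x y (≤-pred (subst (x <_) (trans (length-++-snoc is) (cong suc is-length)) xl)) yk)
            where
            Rt : R-thm i j x y ≡ true
            Rt = ∨-introˡ (x ≡ᵇ j) (cong not (≡ᵇ-false y i ne))
            eT : avoidsAt τ is x y m ≡ false
            eT rewrite <ᵇ-true _ _ lx | <ᵇ-true _ _ xh | eq | <ᵇ-true _ _ lo | <ᵇ-true _ _ hi = refl
            bigT : boxEmpty τ is x y ≡ false
            bigT with true-or-false (boxEmpty τ is x y)
            ... | inj₂ q = q
            ... | inj₁ q = ⊥-elim (false≢true eT (all-elim _ (consec n 1) q min))

        V-suc : ∀ y → y ≤ k → ¬ y ≡ i → V (suc y) ≡ suc (V y)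
        V-suc y yk ne = ≤-antisym le lt
          where
          lt : V y < V (suc y)
          lt = at-mono-< valueBounds-increasing y (suc y) ≤-refl (subst (suc y <_) (sym valueBounds-length) (s≤s (s≤s yk)))
          le : V (suc y) ≤ suc (V y)
          le with ≤-<-connex (V (suc y)) (suc (V y))
          ... | inj₁ q = q
          ... | inj₂ q = ⊥-elim (nothing-between-V y yk ne (suc (V y)) (∈-consec1⁺ (s≤s z≤n) (≤-pred (≤-trans q (V≤suc-n (suc y))))) ≤-refl q)

        V-low : ∀ y → y ≤ i → V y ≡ y
        V-low zero _ = refl
        V-low (suc y) p = trans (V-suc y (≤-trans (n≤1+n y) (≤-trans p i≤k)) (λ e → <-irrefl e p)) (cong suc (V-low y (≤-trans (n≤1+n y) p)))

        V-suc-k : V (suc k) ≡ suc n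
        V-suc-k = subst (λ z → at (sorted ++ (suc n ∷ [])) (suc z) ≡ suc n) sorted-length (at-++-length sorted [] (suc n))

        V-high : ∀ e y → y + e ≡ suc k → i < y → V y ≡ y + D
        V-high zero y eq iy = subst (λ z → V z ≡ z + D) (sym (trans (sym (+-identityʳ y)) eq)) (trans V-suc-k (cong suc (sym (trans (+-comm k D) D+k≡n))))
        V-high (suc e) y eq iy = suc-injective (trans (sym (V-suc y yk ne)) (V-high e (suc y) (trans (sym (+-suc y e)) eq) (m<n⇒m<1+n iy)))
          where
          yk : y ≤ k
          yk = ≤-pred (≤-trans (s≤s (m≤m+n y e)) (≤-reflexive (trans (sym (+-suc y e)) eq)))
          ne : ¬ y ≡ i
          ne e = <-irrefl (sym e) iy

        V≡inflate : ∀ y → y ≤ suc k → V y ≡ inflate y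
        V≡inflate y p with ≤-<-connex y i
        ... | inj₁ lo = trans (V-low y lo) (sym (inflate-low lo))
        ... | inj₂ hi = trans (V-high (suc k ∸ y) y (m+[n∸m]≡n p) hi) (sym (inflate-high hi))

        sorted≡inflate-consec : sorted ≡ map inflate (consec k 1)
        sorted≡inflate-consec = at-ext sorted (map inflate (consec k 1)) (trans sorted-length (sym (trans (length-map inflate (consec k 1)) (length-consec k 1)))) h
          where
          h : ∀ z → z < length sorted → at sorted (suc z) ≡ at (map inflate (consec k 1)) (suc z)
          h z zl = trans (sym (at-++ˡ sorted (suc n ∷ []) z zl))
                     (trans (V≡inflate (suc z) (s≤s (≤-trans (<⇒≤ zl) (≤-reflexive sorted-length))))
                       (sym (trans (at-map inflate (consec k 1) z (subst (z <_) (sym (length-consec k 1)) zk)) (cong inflate (at-consec k 1 z zk)))))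
            where zk : z < k
                  zk = subst (z <_) sorted-length zl

        elem-values : ∀ u → u ∈ consec n 1 → elem u values ≡ extreme u
        elem-values u p = trans (sym (elem-filterB (λ w → elem w values) (consec n 1) p)) (trans (cong (elem u) (trans sorted≡inflate-consec (sym extremes≡inflate-consec))) (elem-filterB extreme (consec n 1) p))

        elem-is : ∀ m → m ∈ consec n 1 → elem m is ≡ extreme (at τ m)
        elem-is m p with true-or-false (elem m is)
        ... | inj₁ q = trans q (sym (trans (sym (elem-values (at τ m) (τ-range m p))) (∈-elem values (∈-map⁺ (at τ) (elem-∈ is q)))))
        ... | inj₂ q with true-or-false (extreme (at τ m))
        ... | inj₂ e = trans q (sym e)
        ... | inj₁ e with ∈-map⁻ (at τ) (elem-∈ values (trans (elem-values (at τ m) (τ-range m p)) e))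
        ... | m' , m'in , eq with at-τ-injective m' m (is⊆consec m' m'in) p (sym eq)
        ... | refl = ⊥-elim (false≢true q (∈-elem is m'in))

        is≡positions : is ≡ positions
        is≡positions = trans is≡filterB (trans (filterB-cong _ _ (consec n 1) elem-is) (sym positions≡filterB))

        values≡extremes : values ≡ filterB extreme τ
        values≡extremes = trans (cong (map (at τ)) is≡positions) values-at-positions

        countB-by-index : (f : ℕ → Bool) (L : List ℕ) → countB f L ≡ countB (λ b → f (at L b)) (consec (length L) 1)
        countB-by-index f L = trans (cong (countB f) (sym (map-at-consec L))) (countB-map f (at L) (consec (length L) 1))

        -- The occurrence is order-isomorphic to π, so its a-th value and π↑'s a-th value have the
        -- same rank among the extreme values, and rank is injective on them.
        rank : ℕ → ℕ
        rank x = countB (λ u → (u <ᵇ x) ∧ extreme u) (consec n 1)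

        countB-below≡rank : ∀ L → Distinct L → (∀ u → u ∈ L → u ∈ consec n 1) → (∀ u → u ∈ consec n 1 → elem u L ≡ extreme u) → ∀ x → countB (λ u → u <ᵇ x) L ≡ rank x
        countB-below≡rank L nd sub h x = trans (countB-restrict (λ u → u <ᵇ x) nd (distinct-consec n 1) sub) (countB-cong _ _ (consec n 1) (λ u p → cong ((u <ᵇ x) ∧_) (h u p)))

        rank-mono-< : ∀ x y → x < y → x ∈ consec n 1 → extreme x ≡ true → rank x < rank y
        rank-mono-< x y xy p ex = countB-mono-< _ _ (consec n 1) mono p g1 f1
          where
          mono : ∀ u → u ∈ consec n 1 → ((u <ᵇ x) ∧ extreme u) ≡ true → ((u <ᵇ y) ∧ extreme u) ≡ true
          mono u _ e = ∧-intro (<ᵇ-true u y (<-trans (<ᵇ-true⁻ u x (∧-elimˡ e)) xy)) (∧-elimʳ {u <ᵇ x} e)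
          g1 : ((x <ᵇ y) ∧ extreme x) ≡ true
          g1 = ∧-intro (<ᵇ-true x y xy) ex
          f1 : ((x <ᵇ x) ∧ extreme x) ≡ false
          f1 = ∧-falseˡ (extreme x) (<ᵇ-false x x ≤-refl)

        values-order≡π↑-order : ∀ a b → a ∈ consec k 1 → b ∈ consec k 1 → (at values a <ᵇ at values b) ≡ (at π↑ a <ᵇ at π↑ b)
        values-order≡π↑-order a b pa pb = trans (⇔ᵇ⇒≡ _ _ (all-elim _ (consec k 1) (all-elim _ (consec k 1) iso-holds pa) pb))
                                (sym (trans (cong₂ _<ᵇ_ (at-π↑ a pa) (at-π↑ b pb)) (inflate-<ᵇ (at π a) (at π b))))

        rank-values≡rank-π↑ : ∀ a → a ∈ consec k 1 → rank (at values a) ≡ rank (at π↑ a)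
        rank-values≡rank-π↑ a pa = begin
            rank (at values a)
          ≡⟨ sym (countB-below≡rank values values-distinct values⊆consec elem-values (at values a)) ⟩
            countB (λ u → u <ᵇ at values a) values
          ≡⟨ countB-by-index _ values ⟩
            countB (λ b → at values b <ᵇ at values a) (consec (length values) 1)
          ≡⟨ cong (λ z → countB (λ b → at values b <ᵇ at values a) (consec z 1)) values-length ⟩
            countB (λ b → at values b <ᵇ at values a) (consec k 1)
          ≡⟨ countB-cong _ _ (consec k 1) (λ b pb → values-order≡π↑-order b a pb pa) ⟩
            countB (λ b → at π↑ b <ᵇ at π↑ a) (consec k 1)
          ≡⟨ cong (λ z → countB (λ b → at π↑ b <ᵇ at π↑ a) (consec z 1)) (sym π↑-length) ⟩
            countB (λ b → at π↑ b <ᵇ at π↑ a) (consec (length π↑) 1)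
          ≡⟨ sym (countB-by-index _ π↑) ⟩
            countB (λ u → u <ᵇ at π↑ a) π↑
          ≡⟨ countB-below≡rank π↑ π↑-distinct (λ u p → proj₁ (π↑-extreme u p)) elem-π↑ (at π↑ a) ⟩
            rank (at π↑ a)
          ∎
          where open ≡-Reasoning

        values≡π↑′ : values ≡ π↑
        values≡π↑′ = at-ext values π↑ (trans values-length (sym π↑-length)) h
          where
          h : ∀ z → z < length values → at values (suc z) ≡ at π↑ (suc z)
          h z zl with <-cmp (at values (suc z)) (at π↑ (suc z))
          ... | tri≈ _ e _ = e
          ... | tri< lt _ _ = ⊥-elim (<-irrefl (rank-values≡rank-π↑ (suc z) pa) (rank-mono-< _ _ lt xin (trans (sym (elem-values _ xin)) (∈-elem values (at-∈ values z zl)))))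
            where pa = ∈-consec1⁺ (s≤s z≤n) (subst (z <_) values-length zl)
                  xin = values⊆consec _ (at-∈ values z zl)
          ... | tri> _ _ gt = ⊥-elim (<-irrefl (sym (rank-values≡rank-π↑ (suc z) pa)) (rank-mono-< _ _ gt (proj₁ (π↑-extreme _ yi)) (proj₂ (π↑-extreme _ yi))))
            where pa = ∈-consec1⁺ (s≤s z≤n) (subst (z <_) values-length zl)
                  yi = at-∈ π↑ z (subst (z <_) (trans values-length (sym π↑-length)) zl)

        V-i : V i ≡ i
        V-i = V-low i ≤-refl
        V-suc-i : V (suc i) ≡ suc (i + D)
        V-suc-i = trans (V≡inflate (suc i) (s≤s i≤k)) (inflate-high ≤-refl)

        box-j-i-empty : boxEmpty τ is j i ≡ true
        box-j-i-empty = subst (λ r → (not r ∨ boxEmpty τ is j i) ≡ true) Rt (box-condition j i j≤k i≤k)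
          where Rt : R-thm i j j i ≡ true
                Rt = ∨-introʳ (not (i ≡ᵇ i)) (≡ᵇ-true j j refl)

        H : MiddleFreeGap 0 0 1 τ (suc n)
        H m m1 ml em lo hi = false≢true eF (all-elim _ (consec n 1) box-j-i-empty min)
          where
          min : m ∈ consec n 1
          min = ∈-consec1⁺ m1 (≤-pred (subst (m <_) (cong suc (PermutationFacts.length≡ τF)) ml))
          mid : i < at τ m × at τ m ≤ D + i
          mid = not-extreme⁻ (trans (sym (cong extreme (atFrom-1 m m1))) em)
          lo' : positionBound is j < m
          lo' = subst (λ z → at (0 ∷ z ++ (suc n ∷ [])) (suc j) < m) (sym is≡positions) lo
          hi' : m < positionBound is (suc j)
          hi' = subst (λ z → m < at (0 ∷ z ++ (suc n ∷ [])) (suc (suc j))) (sym is≡positions) hi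
          eF : avoidsAt τ is j i m ≡ false
          eF rewrite <ᵇ-true _ _ lo' | <ᵇ-true _ _ hi' | V-i | V-suc-i | <ᵇ-true _ _ (proj₁ mid) | <ᵇ-true (at τ m) (suc (i + D)) (s≤s (subst (at τ m ≤_) (+-comm D i) (proj₂ mid))) = refl

        accepts-π↑ : accepts 0 π↑ τ ≡ true
        accepts-π↑ = gap-clear⇒accepts τ 1 0 π↑ 0 (suc n) (trans (sym values≡extremes) values≡π↑′) (s≤s z≤n) τ-length z≤n H

    contains≡accepts : ∀ τ → isPerm n τ ≡ true → contains n meshP τ ≡ accepts 0 π↑ τ
    contains≡accepts τ e with true-or-false (accepts 0 π↑ τ)
    ... | inj₁ g = trans (ForPermutation.FromAccepts.contains-meshP τ (isPerm⇒facts n τ e) g) (sym g)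
    ... | inj₂ g with true-or-false (contains n meshP τ)
    ... | inj₂ c = trans c (sym g)
    ... | inj₁ c with any-elim (isOccurrence τ) (choose (consec n 1) k) (trans (sym (contains≡ τ)) c)
    ... | is , isin , occ = ⊥-elim (false≢true g (ForPermutation.FromOccurrence.accepts-π↑ τ (isPerm⇒facts n τ e) is isin occ))

    isPerm≡covers : ∀ τ → τ ∈ allLists n n → isPerm n τ ≡ covers n (λ _ → true) τ
    isPerm≡covers τ p = trans (cong (_∧ all (λ v → elem v τ) (range 1 n)) (≡ᵇ-true _ _ (allLists-length n n τ p))) (cong (all (λ v → elem v τ)) (range≡consec 1 n))

    s⁺≡countAccepting : s⁺ n meshP ≡ countAccepting n (λ _ → true) 0 π↑
    s⁺≡countAccepting = begin
        length (filter (λ τ → T? (contains n meshP τ)) (filter (λ τ → T? (isPerm n τ)) (allLists n n)))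
      ≡⟨ cong (λ z → length (filter (λ τ → T? (contains n meshP τ)) z)) (filter≡filterB (isPerm n) (allLists n n)) ⟩
        length (filter (λ τ → T? (contains n meshP τ)) (filterB (isPerm n) (allLists n n)))
      ≡⟨ cong length (filter≡filterB (contains n meshP) (filterB (isPerm n) (allLists n n))) ⟩
        length (filterB (contains n meshP) (filterB (isPerm n) (allLists n n)))
      ≡⟨ length-filterB (contains n meshP) (filterB (isPerm n) (allLists n n)) ⟩
        countB (contains n meshP) (filterB (isPerm n) (allLists n n))
      ≡⟨ countB-filterB (contains n meshP) (isPerm n) (allLists n n) ⟩
        countB (λ τ → isPerm n τ ∧ contains n meshP τ) (allLists n n)
      ≡⟨ countB-cong _ _ (allLists n n) pt ⟩
        countAccepting n (λ _ → true) 0 π↑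
      ∎
      where
      open ≡-Reasoning
      pt : ∀ τ → τ ∈ allLists n n → (isPerm n τ ∧ contains n meshP τ) ≡ (covers n (λ _ → true) τ ∧ accepts 0 π↑ τ)
      pt τ p with true-or-false (isPerm n τ)
      ... | inj₁ e = trans (cong (_∧ contains n meshP τ) e) (trans (contains≡accepts τ e) (sym (cong (_∧ accepts 0 π↑ τ) (trans (sym (isPerm≡covers τ p)) e))))
      ... | inj₂ e = trans (cong (_∧ contains n meshP τ) e) (sym (cong (_∧ accepts 0 π↑ τ) (trans (sym (isPerm≡covers τ p)) e)))

    s⁺-formula : s⁺ n meshP * (k ∸ 1) ! ≡ (n ∸ 1) !
    s⁺-formula = trans (cong (_* (k ∸ 1) !) (trans s⁺≡countAccepting countAccepting-initial)) acceptCount-initial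

s⁺-formula : ∀ n k i j π → 1 ≤ k → isPerm k π ≡ true → i ≤ k → j ≤ k → k ≤ n →
  s⁺ n (mesh k π (R-thm i j)) * (k ∸ 1) ! ≡ (n ∸ 1) !
s⁺-formula n k i j π = MeshCount.Assuming.s⁺-formula n k i j π

≤-factorial-pred⇒negligible : (s : ℕ → ℕ) (K : ℕ) → (∀ n → K ≤ n → s n ≤ (n ∸ 1) !) →
  ∀ m → ∃[ N ] (∀ n → N ≤ n → m * s n < n !)
≤-factorial-pred⇒negligible s K s≤ m = suc (m + K) , bound
  where
  bound : ∀ n → suc (m + K) ≤ n → m * s n < n !
  bound (suc n) (s≤s m+K≤n) = begin-strict
      m * s (suc n)          ≤⟨ *-monoʳ-≤ m (s≤ (suc n) (m≤n⇒m≤1+n (≤-trans (m≤n+m K m) m+K≤n))) ⟩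
      m * n !                <⟨ *-monoˡ-< (n !) {{>-nonZero (1≤n! n)}} (s≤s (≤-trans (m≤m+n m K) m+K≤n)) ⟩
      suc n * n !            ∎
    where open ≤-Reasoning

theorem3p5 : (k : ℕ) → 1 ≤ k → (π : List ℕ) → T (isPerm k π) → (i j : ℕ) → i ≤ k → j ≤ k →
    ((n : ℕ) → k ≤ n → s⁺ n (mesh k π (R-thm i j)) * ((k ∸ 1) !) ≡ (n ∸ 1) !)
    × ((m : ℕ) → 1 ≤ m → ∃[ N ] ((n : ℕ) → N ≤ n → m * s⁺ n (mesh k π (R-thm i j)) < n !))
theorem3p5 k k≥1 π πp i j i≤k j≤k = formula , λ m _ → ≤-factorial-pred⇒negligible _ k s⁺≤ m
  where
  formula : (n : ℕ) → k ≤ n → s⁺ n (mesh k π (R-thm i j)) * ((k ∸ 1) !) ≡ (n ∸ 1) !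
  formula n = s⁺-formula n k i j π k≥1 (T⇒≡true πp) i≤k j≤k
  s⁺≤ : ∀ n → k ≤ n → s⁺ n (mesh k π (R-thm i j)) ≤ (n ∸ 1) !
  s⁺≤ n k≤n = ≤-trans (m≤m*n _ ((k ∸ 1) !) {{>-nonZero (1≤n! (k ∸ 1))}}) (≤-reflexive (formula n k≤n))
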